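{- Let $n\in\mathbb{P}$, $I,J\subseteq[n-1]$ with $I\cap J=\emptyset$. Let $i\in\mathbb{P}$, $k\in\mathbb{N}$ be such that $[i+1,i+2k+1]$ is a connected component of $I\cup J$, $[i+1,i+2k+1]\subseteq J$, and $i-1\notin I\cup J$. Let $\bar J:=(J\setminus\{i+2k+1\})\cup\{i\}$. Then $$\sum_{\sigma\in\mathcal{D}^I_J(S_n)}(-1)^{\ell(\sigma)}x^{L(\sigma)}=\sum_{\sigma\in\mathcal{D}^{I}_{J\cup\bar J}(S_n)}(-1)^{\ell(\sigma)}x^{L(\sigma)}=\sum_{\sigma\in\mathcal{D}^{I}_{\bar J}(S_n)}(-1)^{\ell(\sigma)}x^{L(\sigma)}.$$
   Context: $[a,b]=\{a,\ldots,b\}$; $\mathbb{P}$ positive, $\mathbb{N}$ nonnegative integers. Connected components of $K\subseteq[n-1]$ are the maximal intervals of consecutive integers in $K$. $S_n$ is the symmetric group on $[n]$. For $\sigma\in S_n$: $\ell(\sigma)$ = number of pairs $i<j$ with $\sigma(i)>\sigma(j)$; $L(\sigma)$ = number of such pairs with $i\not\equiv j\pmod 2$; $D(\sigma)=\{i\in[n-1]:\sigma(i)>\sigma(i+1)\}$. For disjoint $I,J\subseteq[n-1]$, $\mathcal{D}^I_J(S_n)=\{\sigma\in S_n: J\subseteq D(\sigma)\subseteq[n-1]\setminus I\}$. -}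

module Defs where

open import Data.Bool using (Bool; true; false; _∧_; not; if_then_else_)
open import Data.Nat using (ℕ; zero; suc; _+_; _*_; _∸_; _<ᵇ_; _≡ᵇ_; _%_)
open import Data.Product using (_×_; _,_)
open import Data.List using (List; []; _∷_; map; concatMap; length; _++_)

any : {A : Set} → (A → Bool) → List A → Bool
any p [] = false
any p (x ∷ xs) = if p x then true else any p xs

all : {A : Set} → (A → Bool) → List A → Bool
all p [] = true
all p (x ∷ xs) = p x ∧ all p xs
open import Data.Integer using (ℤ; +_; -_) renaming (_+_ to _+ℤ_)

interval : ℕ → ℕ → List ℕ
interval a b = go a (suc b ∸ a)
  where
  go : ℕ → ℕ → List ℕ
  go s zero = []
  go s (suc m) = s ∷ go (suc s) m

memb : ℕ → List ℕ → Bool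
memb a xs = any (λ y → a ≡ᵇ y) xs

words : ℕ → ℕ → List (List ℕ)
words zero n = [] ∷ []
words (suc k) n = concatMap (λ a → map (a ∷_) (words k n)) (interval 1 n)

distinct : List ℕ → Bool
distinct [] = true
distinct (a ∷ xs) = not (memb a xs) ∧ distinct xs

keep : {A : Set} → (A → Bool) → List A → List A
keep p [] = []
keep p (x ∷ xs) = if p x then x ∷ keep p xs else keep p xs

-- S_n: each permutation σ in one-line notation [σ(1), ..., σ(n)]
-- (the words of length n over [1,n] with pairwise distinct letters)
Sn : ℕ → List (List ℕ)
Sn n = keep distinct (words n n)

-- σ(p) for a 1-based position p (0 outside [1,n])
at : List ℕ → ℕ → ℕ
at [] p = 0
at (a ∷ xs) zero = 0
at (a ∷ xs) (suc zero) = a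
at (a ∷ xs) (suc (suc p)) = at xs (suc p)

pairs : ℕ → List (ℕ × ℕ)
pairs n = concatMap (λ p → map (λ q → (p , q)) (interval (suc p) n)) (interval 1 n)

count : {A : Set} → (A → Bool) → List A → ℕ
count p xs = length (keep p xs)

inverted : List ℕ → ℕ × ℕ → Bool
inverted σ (p , q) = at σ q <ᵇ at σ p

ℓ : ℕ → List ℕ → ℕ
ℓ n σ = count (inverted σ) (pairs n)

Lstat : ℕ → List ℕ → ℕ
Lstat n σ = count (λ pq → inverted σ pq ∧ oddDiff pq) (pairs n)
  where
  oddDiff : ℕ × ℕ → Bool
  oddDiff (p , q) = not (p % 2 ≡ᵇ q % 2)

isDescent : List ℕ → ℕ → Bool
isDescent σ i = at σ (suc i) <ᵇ at σ i

inDIJ : List ℕ → List ℕ → List ℕ → Bool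
inDIJ I J σ = all (isDescent σ) J ∧ all (λ a → not (isDescent σ a)) I

DIJ : ℕ → List ℕ → List ℕ → List (List ℕ)
DIJ n I J = keep (inDIJ I J) (Sn n)

sign : ℕ → ℤ
sign zero = + 1
sign (suc m) = - sign m

sumℤ : List ℤ → ℤ
sumℤ [] = + 0
sumℤ (z ∷ zs) = z +ℤ sumℤ zs

-- coefficient of x^m in  Σ_{σ ∈ D^I_J(S_n)} (-1)^{ℓ(σ)} x^{L(σ)}  ∈ ℤ[x]
genCoeff : ℕ → List ℕ → List ℕ → ℕ → ℤ
genCoeff n I J m = sumℤ (map (λ σ → sign (ℓ n σ)) (keep (λ σ → Lstat n σ ≡ᵇ m) (DIJ n I J)))

-- polynomials in ℤ[x] given by their coefficient functions; equality = equal coefficients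
PolyEq : (ℕ → ℤ) → (ℕ → ℤ) → Set
PolyEq f g = ∀ m → f m ≡ g m
  where open import Relation.Binary.PropositionalEquality using (_≡_)

-- set operations on finite sets of naturals represented as lists (only membership matters)
_∪_ : List ℕ → List ℕ → List ℕ
A ∪ B = A ++ B

remove : ℕ → List ℕ → List ℕ
remove a A = keep (λ b → not (b ≡ᵇ a)) A

Jbar : ℕ → ℕ → List ℕ → List ℕ
Jbar i k J = i ∷ remove (i + 2 * k + 1) J

module Submission where

-- As sets J ∪ J̄ = J ∪ {i} = J̄ ∪ {i+2k+1}.  Hence D^I_J is D^I_{J∪J̄} plus the permutations
-- of D^I_J with an ascent at i, and D^I_J̄ is D^I_{J∪J̄} plus those of D^I_J̄ with an ascent
-- at i+2k+1; it suffices that these two "defect" parts contribute 0.  In a defect part the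
-- window σ(i), ..., σ(i+2k+2) has a fixed descent pattern (an ascent followed by 2k+1
-- descents, resp. 2k+1 descents followed by an ascent).  On windows of each shape we build
-- an involution exchanging two letters at an even distance, all letters in between lying
-- on one side of both.  Such an exchange flips the parity of ℓ, preserves L, keeps the
-- window's descent pattern and so changes descents only at i - 1 and i + 2k + 2, which
-- are not in I ∪ J; the sign-reversing involution principle then kills both defect parts.

open import Defs
open import Data.Nat using (ℕ; suc; _+_; _*_; _∸_; _≤_)
open import Data.List using (List; _∷_)
open import Data.List.Membership.Propositional using (_∈_; _∉_)
open import Data.List.Relation.Unary.All using (All)
open import Data.Product using (_×_; _,_)

module Prelude where

  open import Data.Bool using (Bool; true; false; _∧_; not)
  open import Data.Bool.Properties using (T-≡)
  open import Data.Nat using (ℕ; _<_; _<ᵇ_; _≡ᵇ_)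
  open import Data.Nat.Properties using (<ᵇ⇒<; <⇒<ᵇ; ≡ᵇ⇒≡; ≡⇒≡ᵇ)
  open import Data.Product using (_×_; _,_)
  open import Data.Empty using (⊥-elim)
  open import Function.Bundles using (Equivalence)
  open import Relation.Nullary using (¬_)
  open import Relation.Binary.PropositionalEquality

  𝟙 : Bool → ℕ
  𝟙 true = 1
  𝟙 false = 0

  <ᵇ-true : ∀ {m n} → m < n → (m <ᵇ n) ≡ true
  <ᵇ-true m<n = Equivalence.to T-≡ (<⇒<ᵇ m<n)

  <ᵇ-true⁻ : ∀ {m n} → (m <ᵇ n) ≡ true → m < n
  <ᵇ-true⁻ {m} {n} eq = <ᵇ⇒< m n (Equivalence.from T-≡ eq)

  <ᵇ-false : ∀ {m n} → ¬ m < n → (m <ᵇ n) ≡ false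
  <ᵇ-false {m} {n} m≮n with m <ᵇ n in eq
  ... | false = refl
  ... | true = ⊥-elim (m≮n (<ᵇ-true⁻ eq))

  <ᵇ-false⁻ : ∀ {m n} → (m <ᵇ n) ≡ false → ¬ m < n
  <ᵇ-false⁻ eq m<n with trans (sym eq) (<ᵇ-true m<n)
  ... | ()

  ≡ᵇ-true⁻ : ∀ {m n} → (m ≡ᵇ n) ≡ true → m ≡ n
  ≡ᵇ-true⁻ {m} {n} eq = ≡ᵇ⇒≡ m n (Equivalence.from T-≡ eq)

  ≡ᵇ-false⁻ : ∀ {m n} → (m ≡ᵇ n) ≡ false → m ≢ n
  ≡ᵇ-false⁻ {m} {n} eq m≡n with trans (sym eq) (Equivalence.to T-≡ (≡⇒≡ᵇ m n m≡n))
  ... | ()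

  ≡ᵇ-false : ∀ {m n} → m ≢ n → (m ≡ᵇ n) ≡ false
  ≡ᵇ-false {m} {n} m≢n with m ≡ᵇ n in eq
  ... | false = refl
  ... | true = ⊥-elim (m≢n (≡ᵇ-true⁻ eq))

  ∧-true⁻ : ∀ {a b} → (a ∧ b) ≡ true → a ≡ true × b ≡ true
  ∧-true⁻ {true} {true} _ = refl , refl

  not-true⁻ : ∀ {a} → not a ≡ true → a ≡ false
  not-true⁻ {false} _ = refl

-- Sums over lists, and the sign-reversing involution principle.
module Sums where

  open import Defs
  open import Data.Bool using (Bool; true; false; _∧_; not; if_then_else_)
  open import Data.Nat using (suc; _≤_; s≤s)
  open import Data.Nat.Properties using (≤-refl; ≤-trans; n≤1+n)
  open import Data.Integer using (ℤ; +_; -_) renaming (_+_ to _+ℤ_)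
  import Data.Integer.Properties as ℤ
  open import Data.Integer.Tactic.RingSolver using (solve-∀)
  open import Data.List using (List; []; _∷_; map; length; _++_; [_])
  open import Data.List.Membership.Propositional using (_∈_)
  open import Data.List.Membership.Propositional.Properties using (∈-∃++)
  open import Data.List.Relation.Unary.Any using (here; there)
  open import Data.List.Relation.Unary.All using (_∷_)
  open import Data.List.Relation.Unary.All.Properties using (All¬⇒¬Any)
  open import Data.List.Relation.Unary.Unique.Propositional using (Unique; []; _∷_)
  open import Data.List.Relation.Binary.Permutation.Propositional
    using (_↭_; prep; swap; ↭-sym) renaming (refl to ↭-refl; trans to ↭-trans)
  open import Data.List.Relation.Binary.Permutation.Propositional.Properties
    using (shift; ∈-resp-↭; All-resp-↭; ↭-length)
  open import Data.Product using (_,_; proj₁; proj₂; ∃₂)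
  open import Data.Empty using (⊥-elim)
  open import Relation.Binary.PropositionalEquality hiding ([_])

  Σ[_]_ : {X : Set} → List X → (X → ℤ) → ℤ
  Σ[ xs ] f = sumℤ (map f xs)

  restrict : {X : Set} → (X → Bool) → (X → ℤ) → X → ℤ
  restrict P g x = if P x then g x else + 0

  Σ-cong : {X : Set} {f g : X → ℤ} (xs : List X) → (∀ x → x ∈ xs → f x ≡ g x) → Σ[ xs ] f ≡ Σ[ xs ] g
  Σ-cong [] h = refl
  Σ-cong (x ∷ xs) h = cong₂ _+ℤ_ (h x (here refl)) (Σ-cong xs (λ y m → h y (there m)))

  Σ-+ : {X : Set} (f g : X → ℤ) (xs : List X) → Σ[ xs ] (λ x → f x +ℤ g x) ≡ Σ[ xs ] f +ℤ Σ[ xs ] g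
  Σ-+ f g [] = refl
  Σ-+ f g (x ∷ xs) rewrite Σ-+ f g xs = interchange (f x) (g x) _ _
    where
    interchange : ∀ a b c d → (a +ℤ b) +ℤ (c +ℤ d) ≡ (a +ℤ c) +ℤ (b +ℤ d)
    interchange = solve-∀

  Σ-↭ : {X : Set} (f : X → ℤ) {xs ys : List X} → xs ↭ ys → Σ[ xs ] f ≡ Σ[ ys ] f
  Σ-↭ f ↭-refl = refl
  Σ-↭ f (prep x p) = cong (f x +ℤ_) (Σ-↭ f p)
  Σ-↭ f (swap x y p) rewrite Σ-↭ f p = exchange (f x) (f y) _
    where
    exchange : ∀ a b c → a +ℤ (b +ℤ c) ≡ b +ℤ (a +ℤ c)
    exchange = solve-∀
  Σ-↭ f (↭-trans p q) = trans (Σ-↭ f p) (Σ-↭ f q)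

  Unique-↭ : {X : Set} {xs ys : List X} → xs ↭ ys → Unique xs → Unique ys
  Unique-↭ ↭-refl u = u
  Unique-↭ (prep x p) (a ∷ u) = All-resp-↭ p a ∷ Unique-↭ p u
  Unique-↭ (swap x y p) ((x≢y ∷ a₁) ∷ a₂ ∷ u) =
    ((λ e → x≢y (sym e)) ∷ All-resp-↭ p a₂) ∷ All-resp-↭ p a₁ ∷ Unique-↭ p u
  Unique-↭ (↭-trans p q) u = Unique-↭ q (Unique-↭ p u)

  module SignReversingInvolution {X : Set} (P : X → Bool) (g : X → ℤ) (φ : X → X) where

    record Paired (xs : List X) (x : X) : Set where
      field
        partner-∈ : φ x ∈ xs
        partner-P : P (φ x) ≡ true
        involutive : φ (φ x) ≡ x
        no-fixpoint : φ x ≢ x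
        negates : g (φ x) ≡ - g x

    PairsOff : List X → Set
    PairsOff xs = ∀ x → x ∈ xs → P x ≡ true → Paired xs x

    private
      partner-in-tail : ∀ {x xs z} → φ z ∈ x ∷ xs → φ z ≢ x → φ z ∈ xs
      partner-in-tail (here e) ne = ⊥-elim (ne e)
      partner-in-tail (there m) ne = m

    PairsOff-↭ : ∀ {xs ys} → xs ↭ ys → PairsOff xs → PairsOff ys
    PairsOff-↭ π pairs z z∈ Pz = record
      { partner-∈ = ∈-resp-↭ π partner-∈
      ; partner-P = partner-P ; involutive = involutive ; no-fixpoint = no-fixpoint ; negates = negates }
      where open Paired (pairs z (∈-resp-↭ (↭-sym π) z∈) Pz)

    -- an element without P can be dropped, as it is nobody's partner
    drop-unpaired : ∀ {x xs} → P x ≡ false → PairsOff (x ∷ xs) → PairsOff xs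
    drop-unpaired {x} Px≡false pairs z z∈ Pz = record
      { partner-∈ = partner-in-tail partner-∈ φz≢x
      ; partner-P = partner-P ; involutive = involutive ; no-fixpoint = no-fixpoint ; negates = negates }
      where
      open Paired (pairs z (there z∈) Pz)
      φz≢x : φ z ≢ x
      φz≢x φz≡x with trans (sym Px≡false) (trans (cong P (sym φz≡x)) partner-P)
      ... | ()

    drop-pair : ∀ {x xs} → Unique (x ∷ φ x ∷ xs) → φ (φ x) ≡ x → PairsOff (x ∷ φ x ∷ xs) → PairsOff xs
    drop-pair {x} {xs} ((_ ∷ x∉xs) ∷ φx∉xs ∷ _) φφx pairs z z∈ Pz = record
      { partner-∈ = partner-in-tail (partner-in-tail partner-∈ φz≢x) φz≢φx
      ; partner-P = partner-P ; involutive = involutive ; no-fixpoint = no-fixpoint ; negates = negates }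
      where
      open Paired (pairs z (there (there z∈)) Pz)
      φz≢x : φ z ≢ x
      φz≢x e = All¬⇒¬Any φx∉xs (subst (_∈ xs) (trans (sym involutive) (cong φ e)) z∈)
      φz≢φx : φ z ≢ φ x
      φz≢φx e = All¬⇒¬Any x∉xs (subst (_∈ xs) (trans (sym involutive) (trans (cong φ e) φφx)) z∈)

    -- induction on the length of the list (which drops by two when a pair is removed)
    vanishes-≤ : ∀ N xs → length xs ≤ N → Unique xs → PairsOff xs → Σ[ xs ] (restrict P g) ≡ + 0
    vanishes-≤ N [] _ _ _ = refl
    vanishes-≤ (suc N) (x ∷ ys) (s≤s len) u pairs with P x in Px
    ... | false = trans (ℤ.+-identityˡ _) (vanishes-≤ N ys len (tail u) (drop-unpaired Px pairs))
      where
      tail : ∀ {x xs} → Unique (x ∷ xs) → Unique xs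
      tail (_ ∷ u) = u
    ... | true = begin
        g x +ℤ Σ[ ys ] (restrict P g)                      ≡⟨ cong (g x +ℤ_) (Σ-↭ (restrict P g) ys↭) ⟩
        g x +ℤ (restrict P g (φ x) +ℤ Σ[ rest ] (restrict P g)) ≡⟨ cong (λ b → g x +ℤ (b +ℤ Σ[ rest ] (restrict P g))) restrict-φx ⟩
        g x +ℤ (- g x +ℤ Σ[ rest ] (restrict P g))         ≡⟨ cancel (g x) _ ⟩
        Σ[ rest ] (restrict P g)                           ≡⟨ vanishes-≤ N rest rest-len (tail₂ u′) (drop-pair u′ involutive (PairsOff-↭ π pairs)) ⟩
        + 0                                                ∎
      where
      open ≡-Reasoning
      open Paired (pairs x (here refl) Px)
      ys-split : ∃₂ λ us vs → ys ≡ us ++ [ φ x ] ++ vs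
      ys-split = ∈-∃++ (partner-in-tail partner-∈ no-fixpoint)
      rest : List X
      rest = proj₁ ys-split ++ proj₁ (proj₂ ys-split)
      ys↭ : ys ↭ φ x ∷ rest
      ys↭ = subst (_↭ φ x ∷ rest) (sym (proj₂ (proj₂ ys-split))) (shift (φ x) (proj₁ ys-split) (proj₁ (proj₂ ys-split)))
      π : x ∷ ys ↭ x ∷ φ x ∷ rest
      π = prep x ys↭
      u′ : Unique (x ∷ φ x ∷ rest)
      u′ = Unique-↭ π u
      tail₂ : ∀ {x y xs} → Unique (x ∷ y ∷ xs) → Unique xs
      tail₂ (_ ∷ _ ∷ u) = u
      rest-len : length rest ≤ N
      rest-len = ≤-trans (n≤1+n _) (subst (_≤ N) (↭-length ys↭) len)
      restrict-φx : restrict P g (φ x) ≡ - g x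
      restrict-φx rewrite partner-P = negates
      cancel : ∀ a b → a +ℤ (- a +ℤ b) ≡ b
      cancel = solve-∀

    vanishes : ∀ xs → Unique xs → PairsOff xs → Σ[ xs ] (restrict P g) ≡ + 0
    vanishes xs = vanishes-≤ (length xs) xs ≤-refl

  Σ-restrict-cong : {X : Set} {P Q : X → Bool} (g : X → ℤ) (xs : List X) → (∀ x → P x ≡ Q x) →
    Σ[ xs ] (restrict P g) ≡ Σ[ xs ] (restrict Q g)
  Σ-restrict-cong g xs P≡Q = Σ-cong xs (λ x _ → cong (λ b → if b then g x else + 0) (P≡Q x))

  Σ-restrict-split : {X : Set} (P d : X → Bool) (g : X → ℤ) (xs : List X) →
    Σ[ xs ] (restrict P g) ≡ Σ[ xs ] (restrict (λ x → P x ∧ d x) g) +ℤ Σ[ xs ] (restrict (λ x → P x ∧ not (d x)) g)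
  Σ-restrict-split P d g xs = trans (Σ-cong xs pointwise) (Σ-+ _ _ xs)
    where
    pointwise : ∀ x → x ∈ xs → restrict P g x ≡ restrict (λ x → P x ∧ d x) g x +ℤ restrict (λ x → P x ∧ not (d x)) g x
    pointwise x _ with P x | d x
    ... | true | true = sym (ℤ.+-identityʳ _)
    ... | true | false = sym (ℤ.+-identityˡ _)
    ... | false | _ = refl

module Permutations where

  open import Defs
  open Prelude
  open Sums using (Unique-↭)
  open import Data.Bool using (Bool; true; false; not)
  open import Data.Nat using (ℕ; zero; suc; _∸_; _≤_; _<_; _≤?_; _≡ᵇ_)
  open import Data.Nat.Properties
  open import Data.List using (List; []; _∷_; map; length; _++_; concatMap; cartesianProductWith)
  open import Data.List.Properties using (∷-injective)
  open import Data.List.Membership.Propositional using (_∈_; _∉_)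
  open import Data.List.Membership.Propositional.Properties using (∈-cartesianProductWith⁺; ∈-cartesianProductWith⁻)
  open import Data.List.Relation.Unary.Any using (here; there)
  open import Data.List.Relation.Unary.All using (All; []; _∷_)
  open import Data.List.Relation.Unary.All.Properties using (¬Any⇒All¬; All¬⇒¬Any)
  open import Data.List.Relation.Unary.Unique.Propositional using (Unique; []; _∷_)
  open import Data.List.Relation.Unary.Unique.Propositional.Properties using (cartesianProductWith⁺)
  open import Data.List.Relation.Binary.Permutation.Propositional
    using (_↭_; prep; swap; ↭-sym) renaming (refl to ↭-refl; trans to ↭-trans)
  open import Data.List.Relation.Binary.Permutation.Propositional.Properties
    using (shift; ++⁺ˡ; ↭-length; All-resp-↭)
  open import Data.Product using (_×_; _,_; proj₁)
  open import Data.Empty using (⊥-elim)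
  open import Relation.Nullary using (yes; no)
  open import Relation.Binary.PropositionalEquality

  memb-false⁻ : ∀ a xs → memb a xs ≡ false → a ∉ xs
  memb-false⁻ a (x ∷ xs) eq a∈ with a ≡ᵇ x in a≟x
  memb-false⁻ a (x ∷ xs) () a∈ | true
  memb-false⁻ a (x ∷ xs) eq (here refl) | false = ≡ᵇ-false⁻ {a} a≟x refl
  memb-false⁻ a (x ∷ xs) eq (there a∈) | false = memb-false⁻ a xs eq a∈

  memb-false : ∀ a xs → a ∉ xs → memb a xs ≡ false
  memb-false a [] _ = refl
  memb-false a (x ∷ xs) a∉ with a ≡ᵇ x in a≟x
  ... | true = ⊥-elim (a∉ (here (≡ᵇ-true⁻ a≟x)))
  ... | false = memb-false a xs (λ a∈ → a∉ (there a∈))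

  distinct⇒Unique : ∀ xs → distinct xs ≡ true → Unique xs
  distinct⇒Unique [] _ = []
  distinct⇒Unique (a ∷ xs) eq with ∧-true⁻ {not (memb a xs)} eq
  ... | a-new , rest = ¬Any⇒All¬ xs (memb-false⁻ a xs (not-true⁻ a-new)) ∷ distinct⇒Unique xs rest

  Unique⇒distinct : ∀ xs → Unique xs → distinct xs ≡ true
  Unique⇒distinct [] _ = refl
  Unique⇒distinct (a ∷ xs) (a∉ ∷ u) rewrite memb-false a xs (All¬⇒¬Any a∉) = Unique⇒distinct xs u

  keep-∈ : {A : Set} (p : A → Bool) (xs : List A) {x : A} → x ∈ keep p xs → x ∈ xs × p x ≡ true
  keep-∈ p (y ∷ xs) x∈ with p y in py
  keep-∈ p (y ∷ xs) (here refl) | true = here refl , py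
  keep-∈ p (y ∷ xs) (there x∈) | true with keep-∈ p xs x∈
  ... | x∈xs , px = there x∈xs , px
  keep-∈ p (y ∷ xs) x∈ | false with keep-∈ p xs x∈
  ... | x∈xs , px = there x∈xs , px

  ∈-keep : {A : Set} (p : A → Bool) (xs : List A) {x : A} → x ∈ xs → p x ≡ true → x ∈ keep p xs
  ∈-keep p (y ∷ xs) (here refl) px rewrite px = here refl
  ∈-keep p (y ∷ xs) (there x∈) px with p y
  ... | true = there (∈-keep p xs x∈ px)
  ... | false = ∈-keep p xs x∈ px

  Unique-keep : {A : Set} (p : A → Bool) (xs : List A) → Unique xs → Unique (keep p xs)
  Unique-keep p [] _ = []
  Unique-keep p (y ∷ xs) (y∉ ∷ u) with p y
  ... | true = ¬Any⇒All¬ _ (λ y∈ → All¬⇒¬Any y∉ (keep-∈-sub y∈)) ∷ Unique-keep p xs u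
    where
    keep-∈-sub : ∀ {x} → x ∈ keep p xs → x ∈ xs
    keep-∈-sub x∈ with keep-∈ p xs x∈
    ... | x∈xs , _ = x∈xs
  ... | false = Unique-keep p xs u

  -- Intervals: [a, b] lists exactly the x with a ≤ x ≤ b, once each.
  -- The proofs recurse on the length d = suc b ∸ a of the interval.
  interval-∷ : ∀ a b → a ≤ b → interval a b ≡ a ∷ interval (suc a) b
  interval-∷ a b a≤b rewrite +-∸-assoc 1 a≤b = refl

  interval-[] : ∀ a b → b < a → interval a b ≡ []
  interval-[] a b b<a rewrite m≤n⇒m∸n≡0 b<a = refl

  private
    shorter : ∀ {a b d} → a ≤ b → suc b ∸ a ≡ suc d → suc b ∸ suc a ≡ d
    shorter a≤b eq = suc-injective (trans (sym (+-∸-assoc 1 a≤b)) eq)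

    empty-length : ∀ {a b} → suc b ∸ a ≡ 0 → b < a
    empty-length eq = m∸n≡0⇒m≤n eq

    interval-∈-len : ∀ d a b {x} → suc b ∸ a ≡ d → x ∈ interval a b → a ≤ x × x ≤ b
    interval-∈-len zero a b eq x∈ with () ← subst (_ ∈_) (interval-[] a b (empty-length eq)) x∈
    interval-∈-len (suc d) a b eq x∈ with a ≤? b
    ... | no a≰b with () ← subst (_ ∈_) (interval-[] a b (≰⇒> a≰b)) x∈
    ... | yes a≤b with subst (_ ∈_) (interval-∷ a b a≤b) x∈
    ...   | here refl = ≤-refl , a≤b
    ...   | there x∈′ with interval-∈-len d (suc a) b (shorter a≤b eq) x∈′
    ...     | a<x , x≤b = <⇒≤ a<x , x≤b

    ∈-interval-len : ∀ d a b {x} → suc b ∸ a ≡ d → a ≤ x → x ≤ b → x ∈ interval a b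
    ∈-interval-len zero a b eq a≤x x≤b = ⊥-elim (<⇒≱ (empty-length eq) (≤-trans a≤x x≤b))
    ∈-interval-len (suc d) a b {x} eq a≤x x≤b with a≤b ← ≤-trans a≤x x≤b with a ≟ x
    ... | yes refl = subst (_ ∈_) (sym (interval-∷ a b a≤b)) (here refl)
    ... | no a≢x = subst (_ ∈_) (sym (interval-∷ a b a≤b))
                     (there (∈-interval-len d (suc a) b (shorter a≤b eq) (≤∧≢⇒< a≤x a≢x) x≤b))

    Unique-interval-len : ∀ d a b → suc b ∸ a ≡ d → Unique (interval a b)
    Unique-interval-len zero a b eq rewrite interval-[] a b (empty-length eq) = []
    Unique-interval-len (suc d) a b eq with a ≤? b
    ... | no a≰b rewrite interval-[] a b (≰⇒> a≰b) = []
    ... | yes a≤b rewrite interval-∷ a b a≤b =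
      ¬Any⇒All¬ _ (λ a∈ → 1+n≰n (proj₁ (interval-∈-len d (suc a) b (shorter a≤b eq) a∈)))
        ∷ Unique-interval-len d (suc a) b (shorter a≤b eq)

  interval-∈ : ∀ a b {x} → x ∈ interval a b → a ≤ x × x ≤ b
  interval-∈ a b = interval-∈-len _ a b refl

  ∈-interval : ∀ a b {x} → a ≤ x → x ≤ b → x ∈ interval a b
  ∈-interval a b = ∈-interval-len _ a b refl

  Unique-interval : ∀ a b → Unique (interval a b)
  Unique-interval a b = Unique-interval-len _ a b refl

  InRange : ℕ → ℕ → Set
  InRange n a = 1 ≤ a × a ≤ n

  private
    extend-words : ∀ (As : List ℕ) (W : List (List ℕ)) →
      concatMap (λ a → map (a ∷_) W) As ≡ cartesianProductWith _∷_ As W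
    extend-words [] W = refl
    extend-words (a ∷ As) W = cong (map (a ∷_) W ++_) (extend-words As W)

  words-∈ : ∀ k n {w} → w ∈ words k n → length w ≡ k × All (InRange n) w
  words-∈ zero n (here refl) = refl , []
  words-∈ (suc k) n w∈
    with a , v , a∈ , v∈ , refl ← ∈-cartesianProductWith⁻ _∷_ (interval 1 n) (words k n)
                                    (subst (_ ∈_) (extend-words (interval 1 n) (words k n)) w∈)
    with len , range ← words-∈ k n v∈ = cong suc len , interval-∈ 1 n a∈ ∷ range

  ∈-words : ∀ k n w → length w ≡ k → All (InRange n) w → w ∈ words k n
  ∈-words zero n [] _ _ = here refl
  ∈-words (suc k) n (a ∷ w) len ((1≤a , a≤n) ∷ range) =
    subst (_ ∈_) (sym (extend-words (interval 1 n) (words k n)))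
      (∈-cartesianProductWith⁺ _∷_ (∈-interval 1 n 1≤a a≤n) (∈-words k n w (suc-injective len) range))

  Unique-words : ∀ k n → Unique (words k n)
  Unique-words zero n = [] ∷ []
  Unique-words (suc k) n =
    subst Unique (sym (extend-words (interval 1 n) (words k n)))
      (cartesianProductWith⁺ _∷_ ∷-injective (Unique-interval 1 n) (Unique-words k n))

  IsPerm : ℕ → List ℕ → Set
  IsPerm n σ = length σ ≡ n × All (InRange n) σ × Unique σ

  Unique-Sn : ∀ n → Unique (Sn n)
  Unique-Sn n = Unique-keep distinct (words n n) (Unique-words n n)

  Sn-∈ : ∀ n {σ} → σ ∈ Sn n → IsPerm n σ
  Sn-∈ n {σ} σ∈ with σ∈words , dist ← keep-∈ distinct (words n n) σ∈
                with len , range ← words-∈ n n σ∈words = len , range , distinct⇒Unique σ dist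

  ∈-Sn : ∀ n {σ} → IsPerm n σ → σ ∈ Sn n
  ∈-Sn n {σ} (len , range , u) = ∈-keep distinct (words n n) (∈-words n n σ len range) (Unique⇒distinct σ u)

  exchange-↭ : ∀ (P : List ℕ) A M B Q → (P ++ A ∷ M ++ B ∷ Q) ↭ (P ++ B ∷ M ++ A ∷ Q)
  exchange-↭ P A M B Q =
    ++⁺ˡ P (↭-trans (prep A (shift B M Q)) (↭-trans (swap A B ↭-refl) (prep B (↭-sym (shift A M Q)))))

  exchange-length : ∀ (P : List ℕ) A M B Q → length (P ++ A ∷ M ++ B ∷ Q) ≡ length (P ++ B ∷ M ++ A ∷ Q)
  exchange-length P A M B Q = ↭-length (exchange-↭ P A M B Q)

  Sn-exchange : ∀ n (P : List ℕ) A M B Q → (P ++ A ∷ M ++ B ∷ Q) ∈ Sn n → (P ++ B ∷ M ++ A ∷ Q) ∈ Sn n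
  Sn-exchange n P A M B Q σ∈ with len , range , u ← Sn-∈ n σ∈ =
    ∈-Sn n (trans (sym (↭-length π)) len , All-resp-↭ π range , Unique-↭ π u)
    where π = exchange-↭ P A M B Q

-- Counting (selected) inversions recursively, and their change under an exchange of
-- two letters.
module InversionCounting where

  open import Defs
  open Prelude
  open Permutations using (interval-∷; interval-[])
  open import Data.Bool using (Bool; true; false; _∧_)
  open import Data.Nat using (ℕ; zero; suc; _+_; _≤_; _<_; _<ᵇ_)
  open import Data.Nat.Properties
  open import Data.Nat.Tactic.RingSolver using (solve-∀)
  open import Data.List using (List; []; _∷_; map; length; _++_; concatMap)
  open import Data.List.Relation.Unary.All using (All; []; _∷_)
  open import Data.Product using (_×_; _,_)
  open import Data.Sum using (_⊎_; inj₁; inj₂)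
  open import Relation.Binary.PropositionalEquality

  sumℕ : {X : Set} → (X → ℕ) → List X → ℕ
  sumℕ f [] = 0
  sumℕ f (x ∷ xs) = f x + sumℕ f xs

  count-∷ : {X : Set} (p : X → Bool) (x : X) (xs : List X) → count p (x ∷ xs) ≡ 𝟙 (p x) + count p xs
  count-∷ p x xs with p x
  ... | true = refl
  ... | false = refl

  count-++ : {X : Set} (p : X → Bool) (xs ys : List X) → count p (xs ++ ys) ≡ count p xs + count p ys
  count-++ p [] ys = refl
  count-++ p (x ∷ xs) ys rewrite count-∷ p x (xs ++ ys) | count-∷ p x xs | count-++ p xs ys =
    sym (+-assoc (𝟙 (p x)) _ _)

  count-map : {X Y : Set} (p : Y → Bool) (h : X → Y) (xs : List X) → count p (map h xs) ≡ count (λ x → p (h x)) xs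
  count-map p h [] = refl
  count-map p h (x ∷ xs) rewrite count-∷ p (h x) (map h xs) | count-∷ (λ x → p (h x)) x xs | count-map p h xs = refl

  count-concatMap : {X Y : Set} (p : Y → Bool) (f : X → List Y) (xs : List X) →
    count p (concatMap f xs) ≡ sumℕ (λ x → count p (f x)) xs
  count-concatMap p f [] = refl
  count-concatMap p f (x ∷ xs) rewrite count-++ p (f x) (concatMap f xs) | count-concatMap p f xs = refl

  count-cong : {X : Set} {p q : X → Bool} (xs : List X) → (∀ x → p x ≡ q x) → count p xs ≡ count q xs
  count-cong [] h = refl
  count-cong {p = p} {q} (x ∷ xs) h rewrite count-∷ p x xs | count-∷ q x xs | h x | count-cong xs h = refl

  sumℕ-cong : {X : Set} {f g : X → ℕ} (xs : List X) → (∀ x → f x ≡ g x) → sumℕ f xs ≡ sumℕ g xs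
  sumℕ-cong [] h = refl
  sumℕ-cong (x ∷ xs) h rewrite h x | sumℕ-cong xs h = refl

  private
    start≤end : ∀ t l N → t + suc l ≡ suc N → t ≤ N
    start≤end t l N eq = subst (t ≤_) (suc-injective (trans (sym (+-suc t l)) eq)) (m≤m+n t l)

    end<start : ∀ t N → t + 0 ≡ suc N → N < t
    end<start t N eq = ≤-reflexive (sym (trans (sym (+-identityʳ t)) eq))

    shift-suc : ∀ t l N → t + suc l ≡ suc N → suc t + l ≡ suc N
    shift-suc t l N eq = trans (sym (+-suc t l)) eq

  OnOneSide : ℕ → ℕ → ℕ → Set
  OnOneSide A B m = (m < A × m < B) ⊎ (A < m × B < m)

  -- Counting "inversions" (p, q), p < q, σ(p) > σ(q), restricted to the pairs of
  -- positions selected by c.  With c = true this is ℓ, with c = (p ≢ q mod 2) it is L.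
  module InversionCount (c : ℕ → ℕ → Bool) where

    counted : ℕ → ℕ → ℕ → ℕ → Bool
    counted r t x y = (y <ᵇ x) ∧ c r t

    row : ℕ → ℕ → ℕ → List ℕ → ℕ
    row r x t [] = 0
    row r x t (y ∷ ys) = 𝟙 (counted r t x y) + row r x (suc t) ys

    inv : ℕ → List ℕ → ℕ
    inv s [] = 0
    inv s (x ∷ xs) = row s x (suc s) xs + inv (suc s) xs

    private
      tail-at : (e : ℕ → ℕ) (t : ℕ) {y : ℕ} (ys : List ℕ) → (∀ j → e (t + j) ≡ at (y ∷ ys) (suc j)) →
        ∀ j → e (suc t + j) ≡ at ys (suc j)
      tail-at e t ys h j = trans (cong e (sym (+-suc t j))) (h (suc j))

      row-enum : (e : ℕ → ℕ) (r x : ℕ) (ys : List ℕ) (t N : ℕ) → t + length ys ≡ suc N →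
        (∀ j → e (t + j) ≡ at ys (suc j)) →
        count (λ q → counted r q x (e q)) (interval t N) ≡ row r x t ys
      row-enum e r x [] t N eq h rewrite interval-[] t N (end<start t N eq) = refl
      row-enum e r x (y ∷ ys) t N eq h
        rewrite interval-∷ t N (start≤end t (length ys) N eq)
              | count-∷ (λ q → counted r q x (e q)) t (interval (suc t) N)
              | trans (cong e (sym (+-identityʳ t))) (h 0)
              | row-enum e r x ys (suc t) N (shift-suc t (length ys) N eq) (tail-at e t ys h) = refl

      inv-enum : (e : ℕ → ℕ) (xs : List ℕ) (s N : ℕ) → s + length xs ≡ suc N →
        (∀ j → e (s + j) ≡ at xs (suc j)) →
        sumℕ (λ p → count (λ q → counted p q (e p) (e q)) (interval (suc p) N)) (interval s N) ≡ inv s xs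
      inv-enum e [] s N eq h rewrite interval-[] s N (end<start s N eq) = refl
      inv-enum e (x ∷ xs) s N eq h
        rewrite interval-∷ s N (start≤end s (length xs) N eq)
              | trans (cong e (sym (+-identityʳ s))) (h 0)
              | row-enum e s x xs (suc s) N (shift-suc s (length xs) N eq) (tail-at e s xs h)
              | inv-enum e xs (suc s) N (shift-suc s (length xs) N eq) (tail-at e s xs h) = refl

    inv-pairs : (n : ℕ) (σ : List ℕ) → length σ ≡ n →
      count (λ { (p , q) → counted p q (at σ p) (at σ q) }) (pairs n) ≡ inv 1 σ
    inv-pairs n σ len = begin
      count _ (pairs n)
        ≡⟨ count-concatMap _ (λ p → map (λ q → (p , q)) (interval (suc p) n)) (interval 1 n) ⟩
      sumℕ (λ p → count _ (map (λ q → (p , q)) (interval (suc p) n))) (interval 1 n)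
        ≡⟨ sumℕ-cong (interval 1 n) (λ p → count-map _ (λ q → (p , q)) (interval (suc p) n)) ⟩
      sumℕ (λ p → count (λ q → counted p q (at σ p) (at σ q)) (interval (suc p) n)) (interval 1 n)
        ≡⟨ inv-enum (at σ) σ 1 n (cong suc len) (λ j → refl) ⟩
      inv 1 σ ∎
      where open ≡-Reasoning

    -- Exchanging two letters A, B whose positions t < p have the same parity and
    -- such that every letter strictly between them is smaller than both or larger than
    -- both changes the count only through the pair (t, p) itself, provided c is
    -- symmetric and depends only on the parities of the positions.
    module Exchange (c-sym : ∀ r s → c r s ≡ c s r) (c-periodic : ∀ r s → c r (suc (suc s)) ≡ c r s) where

      c-even-shift : ∀ r t h → c r (h + h + t) ≡ c r t
      c-even-shift r t zero = refl
      c-even-shift r t (suc h) rewrite +-suc h h = trans (c-periodic r (h + h + t)) (c-even-shift r t h)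

      row-++ : ∀ r x t xs ys p → p ≡ t + length xs → row r x t (xs ++ ys) ≡ row r x t xs + row r x p ys
      row-++ r x t [] ys p eq rewrite eq | +-identityʳ t = refl
      row-++ r x t (y ∷ xs) ys p eq rewrite row-++ r x (suc t) xs ys p (trans eq (+-suc t (length xs))) =
        sym (+-assoc (𝟙 (counted r t x y)) _ _)

      row-pos-cong : ∀ a b x t ys → (∀ w → c a w ≡ c b w) → row a x t ys ≡ row b x t ys
      row-pos-cong a b x t [] h = refl
      row-pos-cong a b x t (y ∷ ys) h rewrite row-pos-cong a b x (suc t) ys h | h t = refl

      column : ℕ → List ℕ → ℕ → ℕ → ℕ
      column u [] X p = 0
      column u (m ∷ M) X p = 𝟙 ((X <ᵇ m) ∧ c u p) + column (suc u) M X p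

      crossing : ℕ → List ℕ → ℕ → List ℕ → ℕ
      crossing u [] w Q = 0
      crossing u (m ∷ M) w Q = row u m w Q + crossing (suc u) M w Q

      inv-split : ∀ u M X Q p → p ≡ u + length M →
        inv u (M ++ X ∷ Q) ≡ inv u M + column u M X p + row p X (suc p) Q + inv (suc p) Q + crossing u M (suc p) Q
      inv-split u [] X Q p eq rewrite eq | +-identityʳ u = sym (+-identityʳ _)
      inv-split u (m ∷ M) X Q p eq
        rewrite row-++ u m (suc u) M (X ∷ Q) p (trans eq (+-suc u (length M)))
              | inv-split (suc u) M X Q p (trans eq (+-suc u (length M))) =
          regroup (row u m (suc u) M) (𝟙 (counted u p m X)) (row u m (suc p) Q) (inv (suc u) M)
                  (column (suc u) M X p) (row p X (suc p) Q) (inv (suc p) Q) (crossing (suc u) M (suc p) Q)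
        where
        regroup : ∀ a b d e f g h i → (a + (b + d)) + ((((e + f) + g) + h) + i) ≡ ((((a + e) + (b + f)) + g) + h) + (d + i)
        regroup = solve-∀

      -- a letter m on one side of both A and B forms a counted pair with exactly
      -- as many of (A before m, m before B) as of (B before m, m before A)
      one-side-balance : ∀ A B m k → OnOneSide A B m →
        𝟙 ((m <ᵇ A) ∧ k) + 𝟙 ((B <ᵇ m) ∧ k) ≡ 𝟙 ((m <ᵇ B) ∧ k) + 𝟙 ((A <ᵇ m) ∧ k)
      one-side-balance A B m k (inj₁ (m<A , m<B))
        rewrite <ᵇ-true m<A | <ᵇ-true m<B | <ᵇ-false (<⇒≯ m<B) | <ᵇ-false (<⇒≯ m<A) = refl
      one-side-balance A B m k (inj₂ (A<m , B<m))
        rewrite <ᵇ-true A<m | <ᵇ-true B<m | <ᵇ-false (<⇒≯ B<m) | <ᵇ-false (<⇒≯ A<m) = refl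

      middle-balance : ∀ t A B p M u → All (OnOneSide A B) M → (∀ r → c r p ≡ c t r) →
        row t A u M + column u M B p ≡ row t B u M + column u M A p
      middle-balance t A B p [] u _ _ = refl
      middle-balance t A B p (m ∷ M) u (m-side ∷ M-side) c-tp rewrite c-tp u =
        add-both (𝟙 ((m <ᵇ A) ∧ c t u)) (𝟙 ((B <ᵇ m) ∧ c t u)) (𝟙 ((m <ᵇ B) ∧ c t u)) (𝟙 ((A <ᵇ m) ∧ c t u))
          _ _ _ _ (one-side-balance A B m (c t u) m-side) (middle-balance t A B p M (suc u) M-side c-tp)
        where
        add-both : ∀ a b c′ d r₁ r₂ r₃ r₄ → a + b ≡ c′ + d → r₁ + r₂ ≡ r₃ + r₄ → (a + r₁) + (b + r₂) ≡ (c′ + r₃) + (d + r₄)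
        add-both a b c′ d r₁ r₂ r₃ r₄ e₁ e₂ =
          trans (interchange a b r₁ r₂) (trans (cong₂ _+_ e₁ e₂) (sym (interchange c′ d r₃ r₄)))
          where
          interchange : ∀ a b r₁ r₂ → (a + r₁) + (b + r₂) ≡ (a + b) + (r₁ + r₂)
          interchange = solve-∀

      gap-parity : ∀ t (M : List ℕ) h → length M ≡ suc (h + h) → ∀ w → c (suc t + length M) w ≡ c t w
      gap-parity t M h len w =
        trans (c-sym _ w) (trans (cong (c w) (trans (cong (suc t +_) len) (arith t h)))
          (trans (c-even-shift w t (suc h)) (c-sym w t)))
        where
        arith : ∀ t h → suc t + suc (h + h) ≡ suc h + suc h + t
        arith = solve-∀

      row-exchange : ∀ r x t A B M Q h → length M ≡ suc (h + h) →
        row r x t (A ∷ M ++ B ∷ Q) ≡ row r x t (B ∷ M ++ A ∷ Q)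
      row-exchange r x t A B M Q h len
        rewrite row-++ r x (suc t) M (B ∷ Q) (suc t + length M) refl
              | row-++ r x (suc t) M (A ∷ Q) (suc t + length M) refl
              | trans (c-sym r (suc t + length M)) (trans (gap-parity t M h len r) (c-sym t r)) =
          swap-ends (𝟙 (counted r t x A)) (𝟙 (counted r t x B)) (row r x (suc t) M) (row r x (suc (suc t + length M)) Q)
        where
        swap-ends : ∀ a b d e → a + (d + (b + e)) ≡ b + (d + (a + e))
        swap-ends = solve-∀

      inv-exchange-front : ∀ t A B M Q h → length M ≡ suc (h + h) → All (OnOneSide A B) M →
        inv t (A ∷ M ++ B ∷ Q) + 𝟙 ((A <ᵇ B) ∧ c t t) ≡ inv t (B ∷ M ++ A ∷ Q) + 𝟙 ((B <ᵇ A) ∧ c t t)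
      inv-exchange-front t A B M Q h len M-side
        rewrite row-++ t A (suc t) M (B ∷ Q) (suc t + length M) refl
              | row-++ t B (suc t) M (A ∷ Q) (suc t + length M) refl
              | inv-split (suc t) M B Q (suc t + length M) refl
              | inv-split (suc t) M A Q (suc t + length M) refl
              | row-pos-cong t (suc t + length M) A (suc (suc t + length M)) Q (λ w → sym (gap-parity t M h len w))
              | row-pos-cong t (suc t + length M) B (suc (suc t + length M)) Q (λ w → sym (gap-parity t M h len w))
              | trans (c-sym t (suc t + length M)) (gap-parity t M h len t) =
          regroup (row t A (suc t) M) (row t B (suc t) M) (column (suc t) M A p) (column (suc t) M B p)
            (𝟙 ((B <ᵇ A) ∧ c t t)) (𝟙 ((A <ᵇ B) ∧ c t t))
            (row p A (suc p) Q) (row p B (suc p) Q) (inv (suc t) M) (inv (suc p) Q) (crossing (suc t) M (suc p) Q)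
            (middle-balance t A B p M (suc t) M-side (λ r → trans (c-sym r p) (gap-parity t M h len r)))
        where
        p : ℕ
        p = suc t + length M
        regroup : ∀ rAM rBM cA cB fAB fBA a b GM GQ cr → rAM + cB ≡ rBM + cA →
          (rAM + (fAB + a)) + ((((GM + cB) + b) + GQ) + cr) + fBA ≡ (rBM + (fBA + b)) + ((((GM + cA) + a) + GQ) + cr) + fAB
        regroup rAM rBM cA cB fAB fBA a b GM GQ cr balance =
          trans (e₁ rAM cB fAB a GM b GQ cr fBA) (trans (cong (_+ (fAB + a + GM + b + GQ + cr + fBA)) balance)
            (sym (e₂ rBM cA fBA b GM a GQ cr fAB)))
          where
          e₁ : ∀ rAM cB fAB a GM b GQ cr fBA → (rAM + (fAB + a)) + ((((GM + cB) + b) + GQ) + cr) + fBA ≡ (rAM + cB) + (fAB + a + GM + b + GQ + cr + fBA)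
          e₁ = solve-∀
          e₂ : ∀ rBM cA fBA b GM a GQ cr fAB → (rBM + (fBA + b)) + ((((GM + cA) + a) + GQ) + cr) + fAB ≡ (rBM + cA) + (fAB + a + GM + b + GQ + cr + fBA)
          e₂ = solve-∀

      inv-prefix : ∀ P s q Z Z′ k k′ → q ≡ s + length P → inv q Z + k ≡ inv q Z′ + k′ →
        (∀ r x t → row r x t Z ≡ row r x t Z′) → inv s (P ++ Z) + k ≡ inv s (P ++ Z′) + k′
      inv-prefix [] s q Z Z′ k k′ eq hinv hrow rewrite eq | +-identityʳ s = hinv
      inv-prefix (x ∷ P) s q Z Z′ k k′ eq hinv hrow
        rewrite row-++ s x (suc s) P Z (suc s + length P) refl
              | row-++ s x (suc s) P Z′ (suc s + length P) refl
              | hrow s x (suc s + length P) =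
          trans (+-assoc (row s x (suc s) P + row s x (suc s + length P) Z′) _ k)
            (trans (cong (row s x (suc s) P + row s x (suc s + length P) Z′ +_)
                         (inv-prefix P (suc s) q Z Z′ k k′ (trans eq (+-suc s (length P))) hinv hrow))
              (sym (+-assoc (row s x (suc s) P + row s x (suc s + length P) Z′) _ k′)))

      inv-exchange : ∀ P A B M Q h s → length M ≡ suc (h + h) → All (OnOneSide A B) M →
        inv s (P ++ A ∷ M ++ B ∷ Q) + 𝟙 ((A <ᵇ B) ∧ c (s + length P) (s + length P))
          ≡ inv s (P ++ B ∷ M ++ A ∷ Q) + 𝟙 ((B <ᵇ A) ∧ c (s + length P) (s + length P))
      inv-exchange P A B M Q h s len M-side =
        inv-prefix P s (s + length P) _ _ _ _ refl (inv-exchange-front (s + length P) A B M Q h len M-side)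
          (λ r x t → row-exchange r x t A B M Q h len)

module ExchangeStatistics where

  open import Defs
  open Prelude
  open InversionCounting
  open Permutations using (exchange-length)
  open import Data.Bool using (Bool; true; false; _∧_; not)
  open import Data.Bool.Properties using (∧-identityʳ; ∧-zeroʳ)
  open import Data.Nat using (ℕ; zero; suc; _+_; _<ᵇ_; _≡ᵇ_; _%_)
  open import Data.Nat.Properties
  open import Data.Nat.DivMod using ([m+n]%n≡m%n)
  open import Data.Integer using (-_)
  open import Data.Integer.Properties using (neg-involutive)
  open import Data.List using (List; _∷_; length; _++_)
  open import Data.List.Relation.Unary.All using (All)
  open import Data.Product using (_,_)
  open import Data.Empty using (⊥-elim)
  open import Relation.Binary.PropositionalEquality
  open import Relation.Binary.Definitions using (tri<; tri≈; tri>)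

  all-pairs : ℕ → ℕ → Bool
  all-pairs _ _ = true

  odd-distance : ℕ → ℕ → Bool
  odd-distance r s = not (r % 2 ≡ᵇ s % 2)

  ≡ᵇ-comm : ∀ a b → (a ≡ᵇ b) ≡ (b ≡ᵇ a)
  ≡ᵇ-comm zero zero = refl
  ≡ᵇ-comm zero (suc b) = refl
  ≡ᵇ-comm (suc a) zero = refl
  ≡ᵇ-comm (suc a) (suc b) = ≡ᵇ-comm a b

  odd-distance-sym : ∀ r s → odd-distance r s ≡ odd-distance s r
  odd-distance-sym r s = cong not (≡ᵇ-comm (r % 2) (s % 2))

  odd-distance-periodic : ∀ r s → odd-distance r (suc (suc s)) ≡ odd-distance r s
  odd-distance-periodic r s = cong (λ z → not (r % 2 ≡ᵇ z)) (trans (cong (_% 2) (+-comm 2 s)) ([m+n]%n≡m%n s 2))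

  odd-distance-irrefl : ∀ t → odd-distance t t ≡ false
  odd-distance-irrefl t = cong not (≡ᵇ-refl-true (t % 2))
    where
    ≡ᵇ-refl-true : ∀ a → (a ≡ᵇ a) ≡ true
    ≡ᵇ-refl-true zero = refl
    ≡ᵇ-refl-true (suc a) = ≡ᵇ-refl-true a

  module ℓ-count = InversionCount all-pairs
  module L-count = InversionCount odd-distance
  module ℓ-exchange = ℓ-count.Exchange (λ _ _ → refl) (λ _ _ → refl)
  module L-exchange = L-count.Exchange odd-distance-sym odd-distance-periodic

  ℓ-as-inv : ∀ n σ → length σ ≡ n → ℓ n σ ≡ ℓ-count.inv 1 σ
  ℓ-as-inv n σ len = trans (count-cong (pairs n) (λ _ → sym (∧-identityʳ _))) (ℓ-count.inv-pairs n σ len)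

  L-as-inv : ∀ n σ → length σ ≡ n → Lstat n σ ≡ L-count.inv 1 σ
  L-as-inv n σ len = trans (count-cong (pairs n) (λ { (p , q) → refl })) (L-count.inv-pairs n σ len)

  module _ (n : ℕ) (P : List ℕ) (A B : ℕ) (M Q : List ℕ) (h : ℕ) where

    private
      σ σ′ : List ℕ
      σ = P ++ A ∷ M ++ B ∷ Q
      σ′ = P ++ B ∷ M ++ A ∷ Q
      t : ℕ
      t = 1 + length P

      len′ : length σ ≡ n → length σ′ ≡ n
      len′ len = trans (sym (exchange-length P A M B Q)) len

    exchange-L : length σ ≡ n → length M ≡ suc (h + h) → All (OnOneSide A B) M → Lstat n σ′ ≡ Lstat n σ
    exchange-L len lenM M-side = begin
      Lstat n σ′                                         ≡⟨ L-as-inv n σ′ (len′ len) ⟩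
      L-count.inv 1 σ′                                   ≡⟨ sym (+-identityʳ _) ⟩
      L-count.inv 1 σ′ + 0                               ≡⟨ cong (L-count.inv 1 σ′ +_) (sym (no-self-pair (B <ᵇ A))) ⟩
      L-count.inv 1 σ′ + 𝟙 ((B <ᵇ A) ∧ odd-distance t t) ≡⟨ sym (L-exchange.inv-exchange P A B M Q h 1 lenM M-side) ⟩
      L-count.inv 1 σ + 𝟙 ((A <ᵇ B) ∧ odd-distance t t)  ≡⟨ cong (L-count.inv 1 σ +_) (no-self-pair (A <ᵇ B)) ⟩
      L-count.inv 1 σ + 0                                ≡⟨ +-identityʳ _ ⟩
      L-count.inv 1 σ                                    ≡⟨ sym (L-as-inv n σ len) ⟩
      Lstat n σ                                          ∎
      where
      open ≡-Reasoning
      no-self-pair : ∀ b → 𝟙 (b ∧ odd-distance t t) ≡ 0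
      no-self-pair b rewrite odd-distance-irrefl t | ∧-zeroʳ b = refl

    exchange-ℓ : length σ ≡ n → length M ≡ suc (h + h) → All (OnOneSide A B) M →
      ℓ n σ + 𝟙 (A <ᵇ B) ≡ ℓ n σ′ + 𝟙 (B <ᵇ A)
    exchange-ℓ len lenM M-side
      rewrite ℓ-as-inv n σ len | ℓ-as-inv n σ′ (len′ len)
            | sym (∧-identityʳ (A <ᵇ B)) | sym (∧-identityʳ (B <ᵇ A)) =
      ℓ-exchange.inv-exchange P A B M Q h 1 lenM M-side

    exchange-sign : length σ ≡ n → length M ≡ suc (h + h) → All (OnOneSide A B) M → A ≢ B →
      sign (ℓ n σ′) ≡ - sign (ℓ n σ)
    exchange-sign len lenM M-side A≢B with exchange-ℓ len lenM M-side | <-cmp A B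
    ... | eq | tri< A<B _ _ rewrite <ᵇ-true A<B | <ᵇ-false (<⇒≯ A<B) | +-identityʳ (ℓ n σ′) | sym eq | +-comm (ℓ n σ) 1 = refl
    ... | _  | tri≈ _ A≡B _ = ⊥-elim (A≢B A≡B)
    ... | eq | tri> _ _ B<A rewrite <ᵇ-true B<A | <ᵇ-false (<⇒≯ B<A) | +-identityʳ (ℓ n σ) | eq | +-comm (ℓ n σ′) 1 =
      sym (neg-involutive _)

module Windows where

  open import Defs
  open import Data.Nat using (ℕ; zero; suc; _+_; _∸_; _≤_; _<_; z≤n; s≤s; _<ᵇ_)
  open import Data.Nat.Properties
  open import Data.List using (List; []; _∷_; length; _++_; take; drop)
  open import Data.List.Properties using (length-++; length-take; length-drop; take++drop≡id)
  open import Data.Product using (_×_; _,_; proj₁; proj₂; ∃-syntax)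
  open import Data.Sum using (_⊎_; inj₁; inj₂)
  open import Relation.Binary.PropositionalEquality
  open import Relation.Binary.Definitions using (tri<; tri≈; tri>)
  open import Data.Empty using (⊥-elim)

  -- Reading the letters of a concatenation (positions are 1-based, and `at` is 0 outside).
  at-++ˡ : ∀ (P X : List ℕ) q → q ≤ length P → at (P ++ X) q ≡ at P q
  at-++ˡ [] [] zero _ = refl
  at-++ˡ [] (x ∷ X) zero _ = refl
  at-++ˡ (x ∷ P) X zero _ = refl
  at-++ˡ (x ∷ P) X (suc zero) _ = refl
  at-++ˡ (x ∷ P) X (suc (suc q)) (s≤s q≤) = at-++ˡ P X (suc q) q≤

  at-++ʳ : ∀ (P X : List ℕ) t → at (P ++ X) (length P + suc t) ≡ at X (suc t)
  at-++ʳ [] X t = refl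
  at-++ʳ (x ∷ P) X t rewrite +-suc (length P) t = trans (cong (at (P ++ X)) (sym (+-suc (length P) t))) (at-++ʳ P X t)

  at-++ʳ′ : ∀ (P X : List ℕ) t → 1 ≤ t → at (P ++ X) (length P + t) ≡ at X t
  at-++ʳ′ P X (suc t) _ = at-++ʳ P X t

  take-length-++ : (P Y : List ℕ) → take (length P) (P ++ Y) ≡ P
  take-length-++ [] Y = refl
  take-length-++ (x ∷ P) Y = cong (x ∷_) (take-length-++ P Y)

  drop-length-++ : (P Y : List ℕ) → drop (length P) (P ++ Y) ≡ Y
  drop-length-++ [] Y = refl
  drop-length-++ (x ∷ P) Y = drop-length-++ P Y

  module Window (p0 m : ℕ) where

    pre win rest : List ℕ → List ℕ
    pre σ = take p0 σ
    win σ = take m (drop p0 σ)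
    rest σ = drop m (drop p0 σ)

    replace : List ℕ → List ℕ → List ℕ
    replace Y σ = pre σ ++ Y ++ rest σ

    Fits : List ℕ → Set
    Fits σ = p0 + m ≤ length σ

    replace-win : ∀ σ → replace (win σ) σ ≡ σ
    replace-win σ = trans (cong (pre σ ++_) (take++drop≡id m (drop p0 σ))) (take++drop≡id p0 σ)

    pre-length : ∀ σ → Fits σ → length (pre σ) ≡ p0
    pre-length σ fits = trans (length-take p0 σ) (m≤n⇒m⊓n≡m (≤-trans (m≤m+n p0 m) fits))

    win-length : ∀ σ → Fits σ → length (win σ) ≡ m
    win-length σ fits = trans (length-take m _) (m≤n⇒m⊓n≡m (subst (m ≤_) (sym (length-drop p0 σ)) m≤))
      where
      m≤ : m ≤ length σ ∸ p0
      m≤ = subst (_≤ length σ ∸ p0) (m+n∸m≡n p0 m) (∸-monoˡ-≤ p0 fits)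

    parts : ∀ P Y R → length P ≡ p0 → length Y ≡ m → pre (P ++ Y ++ R) ≡ P × win (P ++ Y ++ R) ≡ Y × rest (P ++ Y ++ R) ≡ R
    parts P Y R refl refl rewrite drop-length-++ P (Y ++ R) =
      take-length-++ P (Y ++ R) , take-length-++ Y R , drop-length-++ Y R

    module _ (σ : List ℕ) (fits : Fits σ) {Y : List ℕ} (lenY : length Y ≡ m) where

      private
        parts-replace : pre (replace Y σ) ≡ pre σ × win (replace Y σ) ≡ Y × rest (replace Y σ) ≡ rest σ
        parts-replace = parts (pre σ) Y (rest σ) (pre-length σ fits) lenY

      win-replace : win (replace Y σ) ≡ Y
      win-replace = proj₁ (proj₂ parts-replace)

      replace-replace : ∀ Z → replace Z (replace Y σ) ≡ replace Z σ
      replace-replace Z = cong₂ (λ P R → P ++ Z ++ R) (proj₁ parts-replace) (proj₂ (proj₂ parts-replace))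

      replace-length : length (replace Y σ) ≡ length σ
      replace-length = begin
        length (pre σ ++ Y ++ rest σ)         ≡⟨ length-++ (pre σ) ⟩
        length (pre σ) + length (Y ++ rest σ) ≡⟨ cong (λ l → length (pre σ) + l) (length-++ Y) ⟩
        length (pre σ) + (length Y + length (rest σ)) ≡⟨ cong (λ l → length (pre σ) + (l + length (rest σ))) (trans lenY (sym (win-length σ fits))) ⟩
        length (pre σ) + (length (win σ) + length (rest σ)) ≡⟨ cong (λ l → length (pre σ) + l) (sym (length-++ (win σ))) ⟩
        length (pre σ) + length (win σ ++ rest σ) ≡⟨ sym (length-++ (pre σ)) ⟩
        length (replace (win σ) σ)            ≡⟨ cong length (replace-win σ) ⟩
        length σ ∎
        where open ≡-Reasoning

      at-replace-outside : ∀ q → q ≤ p0 ⊎ p0 + m < q → at (replace Y σ) q ≡ at σ q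
      at-replace-outside q (inj₁ q≤p0) = begin
        at (pre σ ++ Y ++ rest σ) q         ≡⟨ at-++ˡ (pre σ) _ q q≤pre ⟩
        at (pre σ) q                        ≡⟨ sym (at-++ˡ (pre σ) _ q q≤pre) ⟩
        at (pre σ ++ win σ ++ rest σ) q     ≡⟨ cong (λ τ → at τ q) (replace-win σ) ⟩
        at σ q                              ∎
        where
        open ≡-Reasoning
        q≤pre : q ≤ length (pre σ)
        q≤pre = subst (q ≤_) (sym (pre-length σ fits)) q≤p0
      at-replace-outside q (inj₂ p0+m<q) = begin
        at (pre σ ++ Y ++ rest σ) q                           ≡⟨ cong (at (replace Y σ)) q≡ ⟩
        at (pre σ ++ Y ++ rest σ) (length (pre σ) + (length Y + r)) ≡⟨ at-++ʳ′ (pre σ) _ _ 1≤m+r ⟩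
        at (Y ++ rest σ) (length Y + r)                       ≡⟨ at-++ʳ′ Y _ r 1≤r ⟩
        at (rest σ) r                                         ≡⟨ sym (at-++ʳ′ (win σ) _ r 1≤r) ⟩
        at (win σ ++ rest σ) (length (win σ) + r)             ≡⟨ sym (at-++ʳ′ (pre σ) _ _ 1≤m+r) ⟩
        at (replace (win σ) σ) (length (pre σ) + (length (win σ) + r)) ≡⟨ cong (at (replace (win σ) σ)) (sym q≡′) ⟩
        at (replace (win σ) σ) q                              ≡⟨ cong (λ τ → at τ q) (replace-win σ) ⟩
        at σ q                                                ∎
        where
        open ≡-Reasoning
        r : ℕ
        r = q ∸ (p0 + m)
        1≤r : 1 ≤ r
        1≤r = m<n⇒0<n∸m p0+m<q
        1≤m+r : ∀ {l} → 1 ≤ l + r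
        1≤m+r {l} = ≤-trans 1≤r (m≤n+m r l)
        q-split : q ≡ p0 + (m + r)
        q-split = trans (sym (m+[n∸m]≡n (<⇒≤ p0+m<q))) (+-assoc p0 m r)
        q≡ : q ≡ length (pre σ) + (length Y + r)
        q≡ = trans q-split (cong₂ (λ a b → a + (b + r)) (sym (pre-length σ fits)) (sym lenY))
        q≡′ : q ≡ length (pre σ) + (length (win σ) + r)
        q≡′ = trans q-split (cong₂ (λ a b → a + (b + r)) (sym (pre-length σ fits)) (sym (win-length σ fits)))

    at-window : ∀ σ → Fits σ → ∀ t → 1 ≤ t → t ≤ m → at σ (p0 + t) ≡ at (win σ) t
    at-window σ fits t 1≤t t≤m = begin
      at σ (p0 + t)                                   ≡⟨ cong (λ τ → at τ (p0 + t)) (sym (replace-win σ)) ⟩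
      at (pre σ ++ win σ ++ rest σ) (p0 + t)          ≡⟨ cong (λ p → at (replace (win σ) σ) (p + t)) (sym (pre-length σ fits)) ⟩
      at (pre σ ++ win σ ++ rest σ) (length (pre σ) + t) ≡⟨ at-++ʳ′ (pre σ) _ t 1≤t ⟩
      at (win σ ++ rest σ) t                          ≡⟨ at-++ˡ (win σ) _ t (subst (t ≤_) (sym (win-length σ fits)) t≤m) ⟩
      at (win σ) t                                    ∎
      where open ≡-Reasoning

    descent-window : ∀ σ → Fits σ → ∀ t → 1 ≤ t → suc t ≤ m → isDescent σ (p0 + t) ≡ isDescent (win σ) t
    descent-window σ fits t 1≤t t<m =
      cong₂ _<ᵇ_ (trans (cong (at σ) (sym (+-suc p0 t))) (at-window σ fits (suc t) (s≤s z≤n) t<m))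
                 (at-window σ fits t 1≤t (<⇒≤ t<m))

    -- the positions other than p0 and p0 + m: descents there only involve
    -- letters outside the window, or only letters inside it
    position-cases : ∀ j → j ≢ p0 → j ≢ p0 + m → suc j ≤ p0 ⊎ (∃[ t ] j ≡ p0 + t × 1 ≤ t × suc t ≤ m) ⊎ p0 + m < j
    position-cases j j≢p0 j≢end with <-cmp j p0
    ... | tri< j<p0 _ _ = inj₁ j<p0
    ... | tri≈ _ j≡p0 _ = ⊥-elim (j≢p0 j≡p0)
    ... | tri> _ _ p0<j with <-cmp j (p0 + m)
    ...   | tri≈ _ j≡end _ = ⊥-elim (j≢end j≡end)
    ...   | tri> _ _ end<j = inj₂ (inj₂ end<j)
    ...   | tri< j<end _ _ = inj₂ (inj₁ (j ∸ p0 , sym (m+[n∸m]≡n (<⇒≤ p0<j)) , m<n⇒0<n∸m p0<j ,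
              +-cancelˡ-≤ p0 _ _ (subst (_≤ p0 + m) (trans (cong suc (sym (m+[n∸m]≡n (<⇒≤ p0<j)))) (sym (+-suc p0 (j ∸ p0)))) j<end)))

    descents-replace : ∀ σ → Fits σ → ∀ Y → length Y ≡ m →
      (∀ t → 1 ≤ t → suc t ≤ m → isDescent Y t ≡ isDescent (win σ) t) →
      ∀ j → j ≢ p0 → j ≢ p0 + m → isDescent (replace Y σ) j ≡ isDescent σ j
    descents-replace σ fits Y lenY same j j≢p0 j≢end with position-cases j j≢p0 j≢end
    ... | inj₁ j<p0 = cong₂ _<ᵇ_ (at-replace-outside σ fits lenY (suc j) (inj₁ j<p0))
                                 (at-replace-outside σ fits lenY j (inj₁ (<⇒≤ j<p0)))
    ... | inj₂ (inj₂ end<j) = cong₂ _<ᵇ_ (at-replace-outside σ fits lenY (suc j) (inj₂ (≤-trans end<j (n≤1+n j))))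
                                         (at-replace-outside σ fits lenY j (inj₂ end<j))
    ... | inj₂ (inj₁ (t , refl , 1≤t , t<m)) = begin
      isDescent (replace Y σ) (p0 + t)        ≡⟨ descent-window (replace Y σ) fits′ t 1≤t t<m ⟩
      isDescent (win (replace Y σ)) t         ≡⟨ cong (λ X → isDescent X t) (win-replace σ fits lenY) ⟩
      isDescent Y t                           ≡⟨ same t 1≤t t<m ⟩
      isDescent (win σ) t                     ≡⟨ sym (descent-window σ fits t 1≤t t<m) ⟩
      isDescent σ (p0 + t)                    ∎
      where
      open ≡-Reasoning
      fits′ : Fits (replace Y σ)
      fits′ = subst (p0 + m ≤_) (sym (replace-length σ fits lenY)) fits

module WindowInvolutions where

  open import Defs
  open Sums
  open InversionCounting using (OnOneSide)
  open ExchangeStatistics using (exchange-sign; exchange-L)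
  open Permutations using (Unique-Sn; Sn-∈; Sn-exchange; exchange-length)
  open Windows
  open import Data.Bool using (Bool; true; false; if_then_else_)
  open import Data.Nat using (ℕ; suc; _+_; _≤_; _≡ᵇ_)
  open import Data.Integer using (ℤ; +_; -_)
  open import Data.List using (List; _∷_; length; _++_)
  open import Data.List.Properties using (++-assoc; ++-cancelˡ; ∷-injectiveˡ)
  open import Data.List.Membership.Propositional using (_∈_)
  open import Data.List.Relation.Unary.All using (All)
  open import Data.Product using (_,_; proj₁)
  open import Relation.Binary.PropositionalEquality

  -- Y arises from X by exchanging two distinct letters A, B at an even distance
  -- (the gap M has odd length), all letters in between lying on one side of both.
  record ExchangeForm (X Y : List ℕ) : Set where
    field
      U M W : List ℕ
      A B h : ℕ
      X≡ : X ≡ U ++ A ∷ M ++ B ∷ W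
      Y≡ : Y ≡ U ++ B ∷ M ++ A ∷ W
      gap-odd : length M ≡ suc (h + h)
      gap-side : All (OnOneSide A B) M
      A≢B : A ≢ B

  weight : ℕ → ℕ → List ℕ → ℤ
  weight n d σ = if Lstat n σ ≡ᵇ d then sign (ℓ n σ) else + 0

  weight-exchange : ∀ n d σ τ → sign (ℓ n τ) ≡ - sign (ℓ n σ) → Lstat n τ ≡ Lstat n σ → weight n d τ ≡ - weight n d σ
  weight-exchange n d σ τ sign-flips L-same rewrite L-same with Lstat n σ ≡ᵇ d
  ... | true = sign-flips
  ... | false = refl

  private
    regroup : ∀ (P U : List ℕ) A M B (W R : List ℕ) → P ++ (U ++ A ∷ M ++ B ∷ W) ++ R ≡ (P ++ U) ++ A ∷ M ++ B ∷ (W ++ R)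
    regroup P U A M B W R = begin
      P ++ (U ++ A ∷ M ++ B ∷ W) ++ R   ≡⟨ cong (P ++_) (++-assoc U (A ∷ M ++ B ∷ W) R) ⟩
      P ++ U ++ A ∷ (M ++ B ∷ W) ++ R   ≡⟨ cong (λ Z → P ++ U ++ A ∷ Z) (++-assoc M (B ∷ W) R) ⟩
      P ++ U ++ A ∷ M ++ B ∷ W ++ R     ≡⟨ sym (++-assoc P U _) ⟩
      (P ++ U) ++ A ∷ M ++ B ∷ W ++ R   ∎
      where open ≡-Reasoning

  module WindowInvolution (n p0 m : ℕ) (fits : p0 + m ≤ n)
    (Shape : List ℕ → Set) (ψ : List ℕ → List ℕ)
    (ψ-shape : ∀ X → Shape X → Shape (ψ X))
    (ψ-involutive : ∀ X → Shape X → ψ (ψ X) ≡ X)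
    (ψ-exchange : ∀ X → Shape X → ExchangeForm X (ψ X))
    (shape-descents : ∀ X Y → Shape X → Shape Y → ∀ t → 1 ≤ t → suc t ≤ m → isDescent X t ≡ isDescent Y t)
    (Defect : List ℕ → Bool)
    (defect-shape : ∀ σ → σ ∈ Sn n → Defect σ ≡ true → Shape (Window.win p0 m σ))
    (defect-local : ∀ σ τ → (∀ j → j ≢ p0 → j ≢ p0 + m → isDescent τ j ≡ isDescent σ j) → Defect τ ≡ Defect σ)
    where

    open Window p0 m

    φ : List ℕ → List ℕ
    φ σ = replace (ψ (win σ)) σ

    module Pairing (σ : List ℕ) (σ∈ : σ ∈ Sn n) (defect : Defect σ ≡ true) where

      X : List ℕ
      X = win σ

      shape : Shape X
      shape = defect-shape σ σ∈ defect

      open ExchangeForm (ψ-exchange X shape) public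

      lenσ : length σ ≡ n
      lenσ = proj₁ (Sn-∈ n σ∈)

      fitsσ : Fits σ
      fitsσ = subst (p0 + m ≤_) (sym lenσ) fits

      lenψX : length (ψ X) ≡ m
      lenψX = trans (cong length Y≡) (trans (sym (exchange-length U A M B W)) (trans (cong length (sym X≡)) (win-length σ fitsσ)))

      P R σ′ : List ℕ
      P = pre σ ++ U
      R = W ++ rest σ
      σ′ = P ++ A ∷ M ++ B ∷ R

      σ≡ : σ ≡ σ′
      σ≡ = trans (sym (replace-win σ)) (trans (cong (λ Z → pre σ ++ Z ++ rest σ) X≡) (regroup (pre σ) U A M B W (rest σ)))

      φσ≡ : φ σ ≡ P ++ B ∷ M ++ A ∷ R
      φσ≡ = trans (cong (λ Z → pre σ ++ Z ++ rest σ) Y≡) (regroup (pre σ) U B M A W (rest σ))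

      lenσ′ : length σ′ ≡ n
      lenσ′ = trans (cong length (sym σ≡)) lenσ

      φσ∈ : φ σ ∈ Sn n
      φσ∈ = subst (_∈ Sn n) (sym φσ≡) (Sn-exchange n P A M B R (subst (_∈ Sn n) σ≡ σ∈))

      -- φ σ is defective too, since ψ does not change the descents inside the window
      φσ-defect : Defect (φ σ) ≡ true
      φσ-defect = trans (defect-local σ (φ σ) (descents-replace σ fitsσ (ψ X) lenψX same-descents)) defect
        where
        same-descents : ∀ t → 1 ≤ t → suc t ≤ m → isDescent (ψ X) t ≡ isDescent X t
        same-descents = shape-descents (ψ X) X (ψ-shape X shape) shape

      φφσ : φ (φ σ) ≡ σ
      φφσ = begin
        replace (ψ (win (φ σ))) (φ σ)   ≡⟨ cong (λ Z → replace (ψ Z) (φ σ)) (win-replace σ fitsσ lenψX) ⟩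
        replace (ψ (ψ X)) (φ σ)         ≡⟨ replace-replace σ fitsσ lenψX (ψ (ψ X)) ⟩
        replace (ψ (ψ X)) σ             ≡⟨ cong (λ Z → replace Z σ) (ψ-involutive X shape) ⟩
        replace X σ                     ≡⟨ replace-win σ ⟩
        σ                               ∎
        where open ≡-Reasoning

      -- φ σ ≠ σ, as the windows differ at the position of A
      φσ≢σ : φ σ ≢ σ
      φσ≢σ φσ≡σ = A≢B (sym (∷-injectiveˡ (++-cancelˡ U _ _
        (trans (sym Y≡) (trans (sym (win-replace σ fitsσ lenψX)) (trans (cong win φσ≡σ) X≡))))))

      φσ-weight : ∀ d → weight n d (φ σ) ≡ - weight n d σ
      φσ-weight d = trans (cong (weight n d) φσ≡)
        (trans (weight-exchange n d σ′ (P ++ B ∷ M ++ A ∷ R) (exchange-sign n P A B M R h lenσ′ gap-odd gap-side A≢B)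
                                                             (exchange-L n P A B M R h lenσ′ gap-odd gap-side))
               (cong (λ τ → - weight n d τ) (sym σ≡)))

    pairs-off : ∀ d → SignReversingInvolution.PairsOff Defect (weight n d) φ (Sn n)
    pairs-off d σ σ∈ defect = record
      { partner-∈ = φσ∈ ; partner-P = φσ-defect ; involutive = φφσ ; no-fixpoint = φσ≢σ ; negates = φσ-weight d }
      where open Pairing σ σ∈ defect

    defect-vanishes : ∀ d → Σ[ Sn n ] restrict Defect (weight n d) ≡ + 0
    defect-vanishes d = SignReversingInvolution.vanishes Defect (weight n d) φ (Sn n) (Unique-Sn n) (pairs-off d)

module DecreasingLists where

  open Prelude
  open import Data.Bool using (Bool; true; false; not; if_then_else_)
  open import Data.Nat using (ℕ; zero; suc; _+_; _<_; _<ᵇ_)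
  open import Data.Nat.Properties
  open import Data.List using (List; []; _∷_; length; _++_; [_])
  open import Data.List.Membership.Propositional using (_∉_)
  open import Data.List.Membership.Propositional.Properties using (∈-++⁻)
  open import Data.List.Relation.Unary.Any using (here; there)
  open import Data.List.Relation.Unary.All using (All; []; _∷_) renaming (map to All-map)
  open import Data.List.Relation.Unary.All.Properties using (++⁻ˡ; ++⁻ʳ)
  open import Data.List.Relation.Unary.AllPairs using (AllPairs; []; _∷_)
  import Data.List.Relation.Unary.AllPairs.Properties as AllPairs
  open import Data.Product using (_×_; _,_; proj₁; proj₂; ∃-syntax)
  open import Data.Sum using (_⊎_; inj₁; inj₂)
  open import Data.Empty using (⊥-elim)
  open import Data.Unit using (⊤)
  open import Relation.Nullary using (¬_)
  open import Relation.Binary.PropositionalEquality hiding ([_])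

  Decreasing : List ℕ → Set
  Decreasing = AllPairs (λ x y → y < x)

  Above : List ℕ → List ℕ → Set
  Above xs ys = All (λ x → All (_< x) ys) xs

  Decreasing-++⁺ : ∀ {xs ys} → Decreasing xs → Decreasing ys → Above xs ys → Decreasing (xs ++ ys)
  Decreasing-++⁺ = AllPairs.++⁺

  Decreasing-++⁻ : ∀ xs {ys} → Decreasing (xs ++ ys) → Decreasing xs × Decreasing ys × Above xs ys
  Decreasing-++⁻ [] d = [] , d , []
  Decreasing-++⁻ (x ∷ xs) (x> ∷ d) with Decreasing-++⁻ xs d
  ... | dxs , dys , above = ++⁻ˡ xs x> ∷ dxs , dys , ++⁻ʳ xs x> ∷ above

  Decreasing-∷ʳ⁻ : ∀ xs {b} → Decreasing (xs ++ [ b ]) → All (b <_) xs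
  Decreasing-∷ʳ⁻ xs d = All-map (λ { (b<x ∷ []) → b<x }) (proj₂ (proj₂ (Decreasing-++⁻ xs d)))

  Above-∷ : ∀ {a} (hi lo : List ℕ) → All (a <_) hi → All (_< a) lo → Above hi (a ∷ lo)
  Above-∷ hi lo a<hi lo<a = All-map (λ a<x → a<x ∷ All-map (λ y<a → <-trans y<a a<x) lo<a) a<hi

  ∉-below : ∀ {a} {xs : List ℕ} → All (_< a) xs → a ∉ xs
  ∉-below (x<x ∷ _) (here refl) = <-irrefl refl x<x
  ∉-below (_ ∷ xs<a) (there a∈) = ∉-below xs<a a∈

  ∉-above : ∀ {a} {xs : List ℕ} → All (a <_) xs → a ∉ xs
  ∉-above (x<x ∷ _) (here refl) = <-irrefl refl x<x
  ∉-above (_ ∷ a<xs) (there a∈) = ∉-above a<xs a∈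

  ∉-++ : ∀ {a} (xs : List ℕ) {ys} → a ∉ xs → a ∉ ys → a ∉ xs ++ ys
  ∉-++ xs a∉xs a∉ys a∈ with ∈-++⁻ xs a∈
  ... | inj₁ a∈xs = a∉xs a∈xs
  ... | inj₂ a∈ys = a∉ys a∈ys

  ∉-∷ : ∀ {a b} {xs : List ℕ} → a ≢ b → a ∉ xs → a ∉ b ∷ xs
  ∉-∷ a≢b _ (here a≡b) = a≢b a≡b
  ∉-∷ _ a∉xs (there a∈) = a∉xs a∈

  takeAbove : ℕ → List ℕ → List ℕ
  takeAbove b [] = []
  takeAbove b (x ∷ xs) = if b <ᵇ x then x ∷ takeAbove b xs else []

  dropAbove : ℕ → List ℕ → List ℕ
  dropAbove b [] = []
  dropAbove b (x ∷ xs) = if b <ᵇ x then dropAbove b xs else x ∷ xs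

  takeAbove++dropAbove : ∀ b xs → takeAbove b xs ++ dropAbove b xs ≡ xs
  takeAbove++dropAbove b [] = refl
  takeAbove++dropAbove b (x ∷ xs) with b <ᵇ x
  ... | true = cong (x ∷_) (takeAbove++dropAbove b xs)
  ... | false = refl

  takeAbove-above : ∀ b xs → All (b <_) (takeAbove b xs)
  takeAbove-above b [] = []
  takeAbove-above b (x ∷ xs) with b <ᵇ x in b<ᵇx
  ... | true = <ᵇ-true⁻ b<ᵇx ∷ takeAbove-above b xs
  ... | false = []

  dropAbove-below : ∀ b xs → Decreasing xs → b ∉ xs → All (_< b) (dropAbove b xs)
  dropAbove-below b [] _ _ = []
  dropAbove-below b (x ∷ xs) (x> ∷ d) b∉ with b <ᵇ x in b<ᵇx
  ... | true = dropAbove-below b xs d (λ b∈ → b∉ (there b∈))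
  ... | false = x<b ∷ All-map (λ y<x → <-trans y<x x<b) x>
    where
    x<b : x < b
    x<b = ≤∧≢⇒< (≮⇒≥ (<ᵇ-false⁻ b<ᵇx)) (λ x≡b → b∉ (here (sym x≡b)))

  NotAboveHead : ℕ → List ℕ → Set
  NotAboveHead b [] = ⊤
  NotAboveHead b (y ∷ _) = ¬ b < y

  split-above : ∀ b (xs : List ℕ) {ys} → All (b <_) xs → NotAboveHead b ys →
    takeAbove b (xs ++ ys) ≡ xs × dropAbove b (xs ++ ys) ≡ ys
  split-above b [] {[]} _ _ = refl , refl
  split-above b [] {y ∷ ys} _ y≯b rewrite <ᵇ-false y≯b = refl , refl
  split-above b (x ∷ xs) (b<x ∷ b<xs) stop rewrite <ᵇ-true b<x =
    cong (x ∷_) (proj₁ (split-above b xs b<xs stop)) , proj₂ (split-above b xs b<xs stop)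

  -- Head, tail, last letter and initial part of a list (with dummy values on []).
  head₀ : List ℕ → ℕ
  head₀ [] = 0
  head₀ (x ∷ _) = x

  tail₀ : List ℕ → List ℕ
  tail₀ [] = []
  tail₀ (_ ∷ xs) = xs

  last₀ : List ℕ → ℕ
  last₀ [] = 0
  last₀ (x ∷ []) = x
  last₀ (x ∷ y ∷ xs) = last₀ (y ∷ xs)

  init₀ : List ℕ → List ℕ
  init₀ [] = []
  init₀ (x ∷ []) = []
  init₀ (x ∷ y ∷ xs) = x ∷ init₀ (y ∷ xs)

  last₀-∷ʳ : ∀ xs b → last₀ (xs ++ [ b ]) ≡ b
  last₀-∷ʳ [] b = refl
  last₀-∷ʳ (x ∷ []) b = refl
  last₀-∷ʳ (x ∷ y ∷ xs) b = last₀-∷ʳ (y ∷ xs) b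

  init₀-∷ʳ : ∀ xs b → init₀ (xs ++ [ b ]) ≡ xs
  init₀-∷ʳ [] b = refl
  init₀-∷ʳ (x ∷ []) b = refl
  init₀-∷ʳ (x ∷ y ∷ xs) b = cong (x ∷_) (init₀-∷ʳ (y ∷ xs) b)

  ∷-view : ∀ (xs : List ℕ) → xs ≢ [] → xs ≡ head₀ xs ∷ tail₀ xs
  ∷-view [] xs≢[] = ⊥-elim (xs≢[] refl)
  ∷-view (x ∷ xs) _ = refl

  ∷ʳ-view : ∀ (xs : List ℕ) → xs ≢ [] → xs ≡ init₀ xs ++ [ last₀ xs ]
  ∷ʳ-view [] xs≢[] = ⊥-elim (xs≢[] refl)
  ∷ʳ-view (x ∷ []) _ = refl
  ∷ʳ-view (x ∷ y ∷ xs) _ = cong (x ∷_) (∷ʳ-view (y ∷ xs) (λ ()))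

  length-∷ʳ : ∀ (xs : List ℕ) b → length (xs ++ [ b ]) ≡ suc (length xs)
  length-∷ʳ [] b = refl
  length-∷ʳ (x ∷ xs) b = cong suc (length-∷ʳ xs b)

  length-0 : ∀ (xs : List ℕ) → length xs ≡ 0 → xs ≡ []
  length-0 [] _ = refl

  even : ℕ → Bool
  even zero = true
  even (suc n) = not (even n)

  even-double : ∀ h → even (h + h) ≡ true
  even-double zero = refl
  even-double (suc h) rewrite +-suc h h | even-double h = refl

  odd-double : ∀ h → even (suc (h + h)) ≡ false
  odd-double h rewrite even-double h = refl

  parity : ∀ n → (∃[ h ] n ≡ h + h) ⊎ (∃[ h ] n ≡ suc (h + h))
  parity zero = inj₁ (0 , refl)
  parity (suc n) with parity n
  ... | inj₁ (h , n≡) = inj₂ (h , cong suc n≡)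
  ... | inj₂ (h , n≡) = inj₁ (suc h , trans (cong suc n≡) (cong suc (sym (+-suc h h))))

  double≢odd : ∀ h k → h + h ≢ suc (k + k)
  double≢odd h k eq with trans (sym (even-double h)) (trans (cong even eq) (odd-double k))
  ... | ()

-- The involution on windows of the form a < d₁ > d₂ > ... > d_{2k+2}.
module RisingStarts where

  open InversionCounting using (OnOneSide)
  open WindowInvolutions using (ExchangeForm)
  open DecreasingLists
  open import Data.Bool using (true; false; if_then_else_)
  open import Data.Nat using (ℕ; zero; suc; _+_; _<_)
  open import Data.Nat.Properties
  open import Data.List using (List; []; _∷_; length; _++_; [_])
  open import Data.List.Properties using (length-++; ++-assoc)
  open import Data.List.Membership.Propositional using (_∈_; _∉_)
  open import Data.List.Membership.Propositional.Properties using (∈-++⁺ˡ; ∈-++⁺ʳ)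
  open import Data.List.Relation.Unary.Any using (here)
  open import Data.List.Relation.Unary.All using (All; []; _∷_; lookup) renaming (map to All-map)
  open import Data.List.Relation.Unary.All.Properties using (++⁺; ++⁻ˡ; ++⁻ʳ)
  open import Data.List.Relation.Unary.AllPairs using ([]; _∷_)
  open import Data.Product using (_×_; _,_; proj₁; proj₂; ∃-syntax)
  open import Data.Sum using (inj₁; inj₂)
  open import Data.Empty using (⊥-elim)
  open import Relation.Binary.PropositionalEquality hiding ([_])

  record RisingStart (k : ℕ) (X : List ℕ) : Set where
    field
      a : ℕ
      ds : List ℕ
      X≡ : X ≡ a ∷ ds
      decreasing : Decreasing ds
      ds-length : length ds ≡ suc k + suc k
      a∉ds : a ∉ ds
      x₀ : ℕ
      x₀∈ds : x₀ ∈ ds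
      a<x₀ : a < x₀

  -- Let hi be the letters of ds above a.  The involution exchanges a with the lowest
  -- letter of hi if |hi| is even, and with the highest letter below a if |hi| is odd;
  -- either way the letters in between are exactly those of hi, all above both.
  rise : ℕ → List ℕ → List ℕ → List ℕ
  rise a hi lo = if even (length hi) then last₀ hi ∷ init₀ hi ++ a ∷ lo else head₀ lo ∷ hi ++ a ∷ tail₀ lo

  ψ₁ : List ℕ → List ℕ
  ψ₁ [] = []
  ψ₁ (a ∷ ds) = rise a (takeAbove a ds) (dropAbove a ds)

  rise-even : ∀ a hi lo → even (length hi) ≡ true → rise a hi lo ≡ last₀ hi ∷ init₀ hi ++ a ∷ lo
  rise-even a hi lo even-hi rewrite even-hi = refl

  rise-odd : ∀ a hi lo → even (length hi) ≡ false → rise a hi lo ≡ head₀ lo ∷ hi ++ a ∷ tail₀ lo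
  rise-odd a hi lo odd-hi rewrite odd-hi = refl

  ≢-< : ∀ {a b} → a < b → a ≢ b
  ≢-< a<b refl = <-irrefl refl a<b

  ≢-> : ∀ {a b} → b < a → a ≢ b
  ≢-> b<a refl = <-irrefl refl b<a

  ψ₁-Result : ℕ → List ℕ → Set
  ψ₁-Result k X = RisingStart k (ψ₁ X) × ψ₁ (ψ₁ X) ≡ X × ExchangeForm X (ψ₁ X)

  module RisingStartCases (k a : ℕ) (ds : List ℕ) (dec : Decreasing ds) (len : length ds ≡ suc k + suc k)
    (a∉ds : a ∉ ds) (x₀ : ℕ) (x₀∈ds : x₀ ∈ ds) (a<x₀ : a < x₀) where

    hi lo : List ℕ
    hi = takeAbove a ds
    lo = dropAbove a ds

    ds≡ : ds ≡ hi ++ lo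
    ds≡ = sym (takeAbove++dropAbove a ds)

    dec-hi : Decreasing hi
    dec-hi = proj₁ (Decreasing-++⁻ hi (subst Decreasing ds≡ dec))

    dec-lo : Decreasing lo
    dec-lo = proj₁ (proj₂ (Decreasing-++⁻ hi (subst Decreasing ds≡ dec)))

    a<hi : All (a <_) hi
    a<hi = takeAbove-above a ds

    lo<a : All (_< a) lo
    lo<a = dropAbove-below a ds dec a∉ds

    hi+lo : length hi + length lo ≡ suc k + suc k
    hi+lo = trans (sym (length-++ hi)) (trans (cong length (sym ds≡)) len)

    -- hi is nonempty, as it contains x₀
    hi≢[] : hi ≢ []
    hi≢[] hi≡[] = <-asym a<x₀ (lookup lo<a x₀∈lo)
      where
      x₀∈lo : x₀ ∈ lo
      x₀∈lo = subst (x₀ ∈_) (trans ds≡ (cong (_++ lo) hi≡[])) x₀∈ds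

    -- |hi| even (hence ≥ 2): exchange a with b, the last (lowest) letter of hi = hi′ ++ [b]
    module EvenCase (h′ : ℕ) (hi≡ : length hi ≡ suc h′ + suc h′) where

      hi′ : List ℕ
      hi′ = init₀ hi

      b : ℕ
      b = last₀ hi

      hi≡hi′b : hi ≡ hi′ ++ [ b ]
      hi≡hi′b = ∷ʳ-view hi hi≢[]

      dec-hi′b : Decreasing (hi′ ++ [ b ])
      dec-hi′b = subst Decreasing hi≡hi′b dec-hi

      a<hi′b : All (a <_) (hi′ ++ [ b ])
      a<hi′b = subst (All (a <_)) hi≡hi′b a<hi

      a<hi′ : All (a <_) hi′
      a<hi′ = ++⁻ˡ hi′ a<hi′b

      a<b : a < b
      a<b with ++⁻ʳ hi′ a<hi′b
      ... | a<b ∷ [] = a<b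

      b<hi′ : All (b <_) hi′
      b<hi′ = Decreasing-∷ʳ⁻ hi′ dec-hi′b

      hi′-odd : length hi′ ≡ suc (h′ + h′)
      hi′-odd = suc-injective (trans (sym (length-∷ʳ hi′ b)) (trans (cong length (sym hi≡hi′b)) (trans hi≡ (cong suc (+-suc h′ h′)))))

      ds′ : List ℕ
      ds′ = hi′ ++ a ∷ lo

      ψX≡ : ψ₁ (a ∷ ds) ≡ b ∷ ds′
      ψX≡ = rise-even a hi lo (trans (cong even hi≡) (even-double (suc h′)))

      X≡ : a ∷ ds ≡ a ∷ hi′ ++ b ∷ lo
      X≡ = cong (a ∷_) (trans ds≡ (trans (cong (_++ lo) hi≡hi′b) (++-assoc hi′ [ b ] lo)))

      ds′-length : length ds′ ≡ suc k + suc k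
      ds′-length = trans (length-++ hi′) (trans (+-suc (length hi′) (length lo))
        (trans (cong (_+ length lo) (trans (sym (length-∷ʳ hi′ b)) (cong length (sym hi≡hi′b)))) hi+lo))

      witness : ∃[ x ] x ∈ hi′ × b < x
      witness with hi′ | b<hi′ | hi′-odd
      ... | x ∷ _ | b<x ∷ _ | _ = x , here refl , b<x

      shape : RisingStart k (ψ₁ (a ∷ ds))
      shape = record
        { a = b ; ds = ds′ ; X≡ = ψX≡
        ; decreasing = Decreasing-++⁺ (proj₁ (Decreasing-++⁻ hi′ dec-hi′b)) (lo<a ∷ dec-lo) (Above-∷ hi′ lo a<hi′ lo<a)
        ; ds-length = ds′-length
        ; a∉ds = ∉-++ hi′ (∉-above b<hi′) (∉-∷ (≢-> a<b) (∉-below (All-map (λ x<a → <-trans x<a a<b) lo<a)))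
        ; x₀ = proj₁ witness ; x₀∈ds = ∈-++⁺ˡ (proj₁ (proj₂ witness)) ; a<x₀ = proj₂ (proj₂ witness) }

      involutive : ψ₁ (ψ₁ (a ∷ ds)) ≡ a ∷ ds
      involutive = begin
        ψ₁ (ψ₁ (a ∷ ds))                      ≡⟨ cong ψ₁ ψX≡ ⟩
        rise b (takeAbove b ds′) (dropAbove b ds′) ≡⟨ cong₂ (rise b) (proj₁ split) (proj₂ split) ⟩
        rise b hi′ (a ∷ lo)                   ≡⟨ rise-odd b hi′ (a ∷ lo) (trans (cong even hi′-odd) (odd-double h′)) ⟩
        a ∷ hi′ ++ b ∷ lo                     ≡⟨ sym X≡ ⟩
        a ∷ ds                                ∎
        where
        open ≡-Reasoning
        split : takeAbove b ds′ ≡ hi′ × dropAbove b ds′ ≡ a ∷ lo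
        split = split-above b hi′ {a ∷ lo} b<hi′ (<⇒≯ a<b)

      exchange : ExchangeForm (a ∷ ds) (ψ₁ (a ∷ ds))
      exchange = record
        { U = [] ; M = hi′ ; W = lo ; A = a ; B = b ; h = h′ ; X≡ = X≡ ; Y≡ = ψX≡ ; gap-odd = hi′-odd
        ; gap-side = All-zip a<hi′ b<hi′ ; A≢B = ≢-< a<b }
        where
        All-zip : ∀ {xs} → All (a <_) xs → All (b <_) xs → All (OnOneSide a b) xs
        All-zip [] [] = []
        All-zip (a<x ∷ a<xs) (b<x ∷ b<xs) = inj₂ (a<x , b<x) ∷ All-zip a<xs b<xs

    even-case : ∀ h → length hi ≡ h + h → ψ₁-Result k (a ∷ ds)
    even-case zero hi≡0 = ⊥-elim (hi≢[] (length-0 hi hi≡0))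
    even-case (suc h′) hi≡ = shape , involutive , exchange
      where open EvenCase h′ hi≡

    -- |hi| odd (hence |lo| odd): exchange a with l, the first (highest) letter of lo = l ∷ lo′
    module OddCase (h : ℕ) (hi≡ : length hi ≡ suc (h + h)) where

      lo≢[] : lo ≢ []
      lo≢[] lo≡[] = double≢odd (suc k) h (trans (sym hi+lo) (trans (cong (λ xs → length hi + length xs) lo≡[]) (trans (+-identityʳ _) hi≡)))

      l : ℕ
      l = head₀ lo

      lo′ : List ℕ
      lo′ = tail₀ lo

      lo≡llo′ : lo ≡ l ∷ lo′
      lo≡llo′ = ∷-view lo lo≢[]

      dec-llo′ : Decreasing (l ∷ lo′)
      dec-llo′ = subst Decreasing lo≡llo′ dec-lo

      lo′<l : All (_< l) lo′
      lo′<l with dec-llo′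
      ... | lo′<l ∷ _ = lo′<l

      l<a : l < a
      l<a with subst (All (_< a)) lo≡llo′ lo<a
      ... | l<a ∷ _ = l<a

      lo′<a : All (_< a) lo′
      lo′<a with subst (All (_< a)) lo≡llo′ lo<a
      ... | _ ∷ lo′<a = lo′<a

      ds′ : List ℕ
      ds′ = hi ++ a ∷ lo′

      ψX≡ : ψ₁ (a ∷ ds) ≡ l ∷ ds′
      ψX≡ = rise-odd a hi lo (trans (cong even hi≡) (odd-double h))

      X≡ : a ∷ ds ≡ a ∷ hi ++ l ∷ lo′
      X≡ = cong (a ∷_) (trans ds≡ (cong (hi ++_) lo≡llo′))

      shape : RisingStart k (ψ₁ (a ∷ ds))
      shape = record
        { a = l ; ds = ds′ ; X≡ = ψX≡
        ; decreasing = Decreasing-++⁺ dec-hi (lo′<a ∷ dec-tail dec-llo′) (Above-∷ hi lo′ a<hi lo′<a)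
        ; ds-length = trans (length-++ hi) (trans (cong (λ xs → length hi + length xs) (sym lo≡llo′)) hi+lo)
        ; a∉ds = ∉-++ hi (∉-above (All-map (λ a<x → <-trans l<a a<x) a<hi)) (∉-∷ (≢-< l<a) (∉-below lo′<l))
        ; x₀ = a ; x₀∈ds = ∈-++⁺ʳ hi (here refl) ; a<x₀ = l<a }
        where
        dec-tail : ∀ {x xs} → Decreasing (x ∷ xs) → Decreasing xs
        dec-tail (_ ∷ d) = d

      involutive : ψ₁ (ψ₁ (a ∷ ds)) ≡ a ∷ ds
      involutive = begin
        ψ₁ (ψ₁ (a ∷ ds))                         ≡⟨ cong ψ₁ ψX≡ ⟩
        rise l (takeAbove l ds′) (dropAbove l ds′) ≡⟨ cong₂ (rise l) (proj₁ split) (proj₂ split) ⟩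
        rise l (hi ++ [ a ]) lo′                 ≡⟨ rise-even l (hi ++ [ a ]) lo′ hia-even ⟩
        last₀ (hi ++ [ a ]) ∷ init₀ (hi ++ [ a ]) ++ l ∷ lo′ ≡⟨ cong₂ (λ x xs → x ∷ xs ++ l ∷ lo′) (last₀-∷ʳ hi a) (init₀-∷ʳ hi a) ⟩
        a ∷ hi ++ l ∷ lo′                        ≡⟨ sym X≡ ⟩
        a ∷ ds                                   ∎
        where
        open ≡-Reasoning
        stop : NotAboveHead l lo′
        stop with lo′ | lo′<l
        ... | [] | _ = _
        ... | _ ∷ _ | y<l ∷ _ = <⇒≯ y<l
        split : takeAbove l ds′ ≡ hi ++ [ a ] × dropAbove l ds′ ≡ lo′
        split = subst (λ xs → takeAbove l xs ≡ hi ++ [ a ] × dropAbove l xs ≡ lo′) (++-assoc hi [ a ] lo′)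
                  (split-above l (hi ++ [ a ]) (++⁺ (All-map (λ a<x → <-trans l<a a<x) a<hi) (l<a ∷ [])) stop)
        hia-even : even (length (hi ++ [ a ])) ≡ true
        hia-even = trans (cong even (trans (length-∷ʳ hi a) (cong suc (trans hi≡ (sym (+-suc h h)))))) (even-double (suc h))

      exchange : ExchangeForm (a ∷ ds) (ψ₁ (a ∷ ds))
      exchange = record
        { U = [] ; M = hi ; W = lo′ ; A = a ; B = l ; h = h ; X≡ = X≡ ; Y≡ = ψX≡ ; gap-odd = hi≡
        ; gap-side = All-map (λ a<x → inj₂ (a<x , <-trans l<a a<x)) a<hi ; A≢B = ≢-> l<a }

    odd-case : ∀ h → length hi ≡ suc (h + h) → ψ₁-Result k (a ∷ ds)
    odd-case h hi≡ = shape , involutive , exchange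
      where open OddCase h hi≡

  ψ₁-properties : ∀ k X → RisingStart k X → ψ₁-Result k X
  ψ₁-properties k X record { a = a ; ds = ds ; X≡ = refl ; decreasing = dec ; ds-length = len ; a∉ds = a∉ds
                           ; x₀ = x₀ ; x₀∈ds = x₀∈ds ; a<x₀ = a<x₀ }
    with parity (length (RisingStartCases.hi k a ds dec len a∉ds x₀ x₀∈ds a<x₀))
  ... | inj₁ (h , even-hi) = RisingStartCases.even-case k a ds dec len a∉ds x₀ x₀∈ds a<x₀ h even-hi
  ... | inj₂ (h , odd-hi) = RisingStartCases.odd-case k a ds dec len a∉ds x₀ x₀∈ds a<x₀ h odd-hi

-- The involution on windows of the form d₁ > d₂ > ... > d_{2k+2} < z.
module FallingEnds where

  open InversionCounting using (OnOneSide)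
  open WindowInvolutions using (ExchangeForm)
  open DecreasingLists
  open RisingStarts using (≢-<; ≢->)
  open import Data.Bool using (true; false; if_then_else_)
  open import Data.Nat using (ℕ; zero; suc; _+_; _<_)
  open import Data.Nat.Properties
  open import Data.List using (List; []; _∷_; length; _++_; [_])
  open import Data.List.Properties using (length-++; ++-assoc; ++-identityʳ)
  open import Data.List.Membership.Propositional using (_∈_; _∉_)
  open import Data.List.Membership.Propositional.Properties using (∈-++⁺ʳ)
  open import Data.List.Relation.Unary.Any using (here; there)
  open import Data.List.Relation.Unary.All using (All; []; _∷_; lookup) renaming (map to All-map)
  open import Data.List.Relation.Unary.All.Properties using (++⁺; ++⁻ˡ; ++⁻ʳ)
  open import Data.List.Relation.Unary.AllPairs using ([]; _∷_)
  open import Data.Product using (_×_; _,_; proj₁; proj₂; ∃-syntax)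
  open import Data.Sum using (inj₁; inj₂)
  open import Data.Empty using (⊥-elim)
  open import Relation.Binary.PropositionalEquality hiding ([_])

  record FallingEnd (k : ℕ) (X : List ℕ) : Set where
    field
      ds : List ℕ
      z : ℕ
      X≡ : X ≡ ds ++ [ z ]
      decreasing : Decreasing ds
      ds-length : length ds ≡ suc k + suc k
      z∉ds : z ∉ ds
      x₀ : ℕ
      x₀∈ds : x₀ ∈ ds
      x₀<z : x₀ < z

  -- Let lo be the letters of ds below z.  The involution exchanges z with the highest
  -- letter of lo if |lo| is even, and with the lowest letter above z if |lo| is odd;
  -- either way the letters in between are exactly those of lo, all below both.
  fall : List ℕ → ℕ → List ℕ
  fall ds z = if even (length lo) then hi ++ z ∷ tail₀ lo ++ [ head₀ lo ] else init₀ hi ++ z ∷ lo ++ [ last₀ hi ]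
    where
    hi = takeAbove z ds
    lo = dropAbove z ds

  ψ₂ : List ℕ → List ℕ
  ψ₂ X = fall (init₀ X) (last₀ X)

  ψ₂-∷ʳ : ∀ ds z → ψ₂ (ds ++ [ z ]) ≡ fall ds z
  ψ₂-∷ʳ ds z = cong₂ fall (init₀-∷ʳ ds z) (last₀-∷ʳ ds z)

  fall-split : ∀ ds z hi lo → takeAbove z ds ≡ hi → dropAbove z ds ≡ lo →
    fall ds z ≡ (if even (length lo) then hi ++ z ∷ tail₀ lo ++ [ head₀ lo ] else init₀ hi ++ z ∷ lo ++ [ last₀ hi ])
  fall-split ds z hi lo refl refl = refl

  fall-even : ∀ ds z → even (length (dropAbove z ds)) ≡ true →
    fall ds z ≡ takeAbove z ds ++ z ∷ tail₀ (dropAbove z ds) ++ [ head₀ (dropAbove z ds) ]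
  fall-even ds z even-lo rewrite even-lo = refl

  fall-odd : ∀ ds z → even (length (dropAbove z ds)) ≡ false →
    fall ds z ≡ init₀ (takeAbove z ds) ++ z ∷ dropAbove z ds ++ [ last₀ (takeAbove z ds) ]
  fall-odd ds z odd-lo rewrite odd-lo = refl

  ψ₂-Result : ℕ → List ℕ → Set
  ψ₂-Result k X = FallingEnd k (ψ₂ X) × ψ₂ (ψ₂ X) ≡ X × ExchangeForm X (ψ₂ X)

  module FallingEndCases (k : ℕ) (ds : List ℕ) (z : ℕ) (dec : Decreasing ds) (len : length ds ≡ suc k + suc k)
    (z∉ds : z ∉ ds) (x₀ : ℕ) (x₀∈ds : x₀ ∈ ds) (x₀<z : x₀ < z) where

    hi lo : List ℕ
    hi = takeAbove z ds
    lo = dropAbove z ds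

    ds≡ : ds ≡ hi ++ lo
    ds≡ = sym (takeAbove++dropAbove z ds)

    dec-hi : Decreasing hi
    dec-hi = proj₁ (Decreasing-++⁻ hi (subst Decreasing ds≡ dec))

    dec-lo : Decreasing lo
    dec-lo = proj₁ (proj₂ (Decreasing-++⁻ hi (subst Decreasing ds≡ dec)))

    z<hi : All (z <_) hi
    z<hi = takeAbove-above z ds

    lo<z : All (_< z) lo
    lo<z = dropAbove-below z ds dec z∉ds

    hi+lo : length hi + length lo ≡ suc k + suc k
    hi+lo = trans (sym (length-++ hi)) (trans (cong length (sym ds≡)) len)

    -- lo is nonempty, as it contains x₀
    lo≢[] : lo ≢ []
    lo≢[] lo≡[] = <-asym x₀<z (lookup z<hi x₀∈hi)
      where
      x₀∈hi : x₀ ∈ hi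
      x₀∈hi = subst (x₀ ∈_) (trans ds≡ (trans (cong (hi ++_) lo≡[]) (++-identityʳ hi))) x₀∈ds

    -- |lo| even (hence ≥ 2): exchange z with l, the first (highest) letter of lo = l ∷ lo′
    module EvenCase (h′ : ℕ) (lo≡ : length lo ≡ suc h′ + suc h′) where

      l : ℕ
      l = head₀ lo

      lo′ : List ℕ
      lo′ = tail₀ lo

      lo≡llo′ : lo ≡ l ∷ lo′
      lo≡llo′ = ∷-view lo lo≢[]

      dec-llo′ : Decreasing (l ∷ lo′)
      dec-llo′ = subst Decreasing lo≡llo′ dec-lo

      lo′<l : All (_< l) lo′
      lo′<l with dec-llo′
      ... | lo′<l ∷ _ = lo′<l

      l<z : l < z
      l<z with subst (All (_< z)) lo≡llo′ lo<z
      ... | l<z ∷ _ = l<z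

      lo′<z : All (_< z) lo′
      lo′<z with subst (All (_< z)) lo≡llo′ lo<z
      ... | _ ∷ lo′<z = lo′<z

      lo′-odd : length lo′ ≡ suc (h′ + h′)
      lo′-odd = suc-injective (trans (cong length (sym lo≡llo′)) (trans lo≡ (cong suc (+-suc h′ h′))))

      ds′ : List ℕ
      ds′ = hi ++ z ∷ lo′

      ψX≡ : ψ₂ (ds ++ [ z ]) ≡ ds′ ++ [ l ]
      ψX≡ = trans (ψ₂-∷ʳ ds z) (trans (fall-even ds z (trans (cong even lo≡) (even-double (suc h′))))
              (sym (++-assoc hi (z ∷ lo′) [ l ])))

      X≡ : ds ++ [ z ] ≡ hi ++ l ∷ lo′ ++ z ∷ []
      X≡ = trans (cong (_++ [ z ]) (trans ds≡ (cong (hi ++_) lo≡llo′))) (++-assoc hi (l ∷ lo′) [ z ])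

      witness : ∃[ y ] y ∈ lo′ × y < l
      witness with lo′ | lo′<l | lo′-odd
      ... | y ∷ _ | y<l ∷ _ | _ = y , here refl , y<l

      shape : FallingEnd k (ψ₂ (ds ++ [ z ]))
      shape = record
        { ds = ds′ ; z = l ; X≡ = ψX≡
        ; decreasing = Decreasing-++⁺ dec-hi (lo′<z ∷ dec-tail dec-llo′) (Above-∷ hi lo′ z<hi lo′<z)
        ; ds-length = trans (length-++ hi) (trans (cong (λ xs → length hi + length xs) (sym lo≡llo′)) hi+lo)
        ; z∉ds = ∉-++ hi (∉-above (All-map (λ z<x → <-trans l<z z<x) z<hi)) (∉-∷ (≢-< l<z) (∉-below lo′<l))
        ; x₀ = proj₁ witness ; x₀∈ds = ∈-++⁺ʳ hi (there (proj₁ (proj₂ witness))) ; x₀<z = proj₂ (proj₂ witness) }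
        where
        dec-tail : ∀ {x xs} → Decreasing (x ∷ xs) → Decreasing xs
        dec-tail (_ ∷ d) = d

      involutive : ψ₂ (ψ₂ (ds ++ [ z ])) ≡ ds ++ [ z ]
      involutive = begin
        ψ₂ (ψ₂ (ds ++ [ z ]))           ≡⟨ cong ψ₂ ψX≡ ⟩
        ψ₂ (ds′ ++ [ l ])               ≡⟨ ψ₂-∷ʳ ds′ l ⟩
        fall ds′ l                      ≡⟨ fall-split ds′ l (hi ++ [ z ]) lo′ (proj₁ split) (proj₂ split) ⟩
        (if even (length lo′) then even-branch else odd-branch)
                                        ≡⟨ cong (λ b → if b then even-branch else odd-branch) (trans (cong even lo′-odd) (odd-double h′)) ⟩
        odd-branch                      ≡⟨ cong₂ (λ xs x → xs ++ l ∷ lo′ ++ [ x ]) (init₀-∷ʳ hi z) (last₀-∷ʳ hi z) ⟩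
        hi ++ l ∷ lo′ ++ [ z ]          ≡⟨ sym X≡ ⟩
        ds ++ [ z ]                     ∎
        where
        open ≡-Reasoning
        even-branch odd-branch : List ℕ
        even-branch = (hi ++ [ z ]) ++ l ∷ tail₀ lo′ ++ [ head₀ lo′ ]
        odd-branch = init₀ (hi ++ [ z ]) ++ l ∷ lo′ ++ [ last₀ (hi ++ [ z ]) ]
        stop : NotAboveHead l lo′
        stop with lo′ | lo′<l
        ... | [] | _ = _
        ... | _ ∷ _ | y<l ∷ _ = <⇒≯ y<l
        split : takeAbove l ds′ ≡ hi ++ [ z ] × dropAbove l ds′ ≡ lo′
        split = subst (λ xs → takeAbove l xs ≡ hi ++ [ z ] × dropAbove l xs ≡ lo′) (++-assoc hi [ z ] lo′)
                  (split-above l (hi ++ [ z ]) (++⁺ (All-map (λ z<x → <-trans l<z z<x) z<hi) (l<z ∷ [])) stop)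

      exchange : ExchangeForm (ds ++ [ z ]) (ψ₂ (ds ++ [ z ]))
      exchange = record
        { U = hi ; M = lo′ ; W = [] ; A = l ; B = z ; h = h′
        ; X≡ = X≡ ; Y≡ = trans ψX≡ (++-assoc hi (z ∷ lo′) [ l ]) ; gap-odd = lo′-odd
        ; gap-side = All-zip lo′<l lo′<z ; A≢B = ≢-< l<z }
        where
        All-zip : ∀ {xs} → All (_< l) xs → All (_< z) xs → All (OnOneSide l z) xs
        All-zip [] [] = []
        All-zip (x<l ∷ xs<l) (x<z ∷ xs<z) = inj₁ (x<l , x<z) ∷ All-zip xs<l xs<z

    even-case : ∀ h → length lo ≡ h + h → ψ₂-Result k (ds ++ [ z ])
    even-case zero lo≡0 = ⊥-elim (lo≢[] (length-0 lo lo≡0))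
    even-case (suc h′) lo≡ = shape , involutive , exchange
      where open EvenCase h′ lo≡

    -- |lo| odd (hence |hi| odd): exchange z with g, the last (lowest) letter of hi = hi′ ++ [g]
    module OddCase (h : ℕ) (lo≡ : length lo ≡ suc (h + h)) where

      hi≢[] : hi ≢ []
      hi≢[] hi≡[] = double≢odd (suc k) h (trans (sym hi+lo) (trans (cong (λ xs → length xs + length lo) hi≡[]) lo≡))

      hi′ : List ℕ
      hi′ = init₀ hi

      g : ℕ
      g = last₀ hi

      hi≡hi′g : hi ≡ hi′ ++ [ g ]
      hi≡hi′g = ∷ʳ-view hi hi≢[]

      dec-hi′g : Decreasing (hi′ ++ [ g ])
      dec-hi′g = subst Decreasing hi≡hi′g dec-hi

      z<hi′g : All (z <_) (hi′ ++ [ g ])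
      z<hi′g = subst (All (z <_)) hi≡hi′g z<hi

      z<hi′ : All (z <_) hi′
      z<hi′ = ++⁻ˡ hi′ z<hi′g

      z<g : z < g
      z<g with ++⁻ʳ hi′ z<hi′g
      ... | z<g ∷ [] = z<g

      g<hi′ : All (g <_) hi′
      g<hi′ = Decreasing-∷ʳ⁻ hi′ dec-hi′g

      ds′ : List ℕ
      ds′ = hi′ ++ z ∷ lo

      ψX≡ : ψ₂ (ds ++ [ z ]) ≡ ds′ ++ [ g ]
      ψX≡ = trans (ψ₂-∷ʳ ds z) (trans (fall-odd ds z (trans (cong even lo≡) (odd-double h)))
              (sym (++-assoc hi′ (z ∷ lo) [ g ])))

      X≡ : ds ++ [ z ] ≡ hi′ ++ g ∷ lo ++ z ∷ []
      X≡ = trans (cong (_++ [ z ]) (trans ds≡ (trans (cong (_++ lo) hi≡hi′g) (++-assoc hi′ [ g ] lo))))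
             (++-assoc hi′ (g ∷ lo) [ z ])

      shape : FallingEnd k (ψ₂ (ds ++ [ z ]))
      shape = record
        { ds = ds′ ; z = g ; X≡ = ψX≡
        ; decreasing = Decreasing-++⁺ (proj₁ (Decreasing-++⁻ hi′ dec-hi′g)) (lo<z ∷ dec-lo) (Above-∷ hi′ lo z<hi′ lo<z)
        ; ds-length = trans (length-++ hi′) (trans (+-suc (length hi′) (length lo))
            (trans (cong (_+ length lo) (trans (sym (length-∷ʳ hi′ g)) (cong length (sym hi≡hi′g)))) hi+lo))
        ; z∉ds = ∉-++ hi′ (∉-above g<hi′) (∉-∷ (≢-> z<g) (∉-below (All-map (λ x<z → <-trans x<z z<g) lo<z)))
        ; x₀ = z ; x₀∈ds = ∈-++⁺ʳ hi′ (here refl) ; x₀<z = z<g }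

      involutive : ψ₂ (ψ₂ (ds ++ [ z ])) ≡ ds ++ [ z ]
      involutive = begin
        ψ₂ (ψ₂ (ds ++ [ z ]))           ≡⟨ cong ψ₂ ψX≡ ⟩
        ψ₂ (ds′ ++ [ g ])               ≡⟨ ψ₂-∷ʳ ds′ g ⟩
        fall ds′ g                      ≡⟨ fall-split ds′ g hi′ (z ∷ lo) (proj₁ split) (proj₂ split) ⟩
        (if even (length (z ∷ lo)) then even-branch else odd-branch)
                                        ≡⟨ cong (λ b → if b then even-branch else odd-branch) zlo-even ⟩
        even-branch                     ≡⟨ sym X≡ ⟩
        ds ++ [ z ]                     ∎
        where
        open ≡-Reasoning
        even-branch odd-branch : List ℕ
        even-branch = hi′ ++ g ∷ lo ++ [ z ]
        odd-branch = init₀ hi′ ++ g ∷ (z ∷ lo) ++ [ last₀ hi′ ]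
        split : takeAbove g ds′ ≡ hi′ × dropAbove g ds′ ≡ z ∷ lo
        split = split-above g hi′ {z ∷ lo} g<hi′ (<⇒≯ z<g)
        zlo-even : even (length (z ∷ lo)) ≡ true
        zlo-even = trans (cong (λ n → even (suc n)) (trans lo≡ (sym (+-suc h h)))) (even-double (suc h))

      exchange : ExchangeForm (ds ++ [ z ]) (ψ₂ (ds ++ [ z ]))
      exchange = record
        { U = hi′ ; M = lo ; W = [] ; A = g ; B = z ; h = h
        ; X≡ = X≡ ; Y≡ = trans ψX≡ (++-assoc hi′ (z ∷ lo) [ g ]) ; gap-odd = lo≡
        ; gap-side = All-map (λ x<z → inj₁ (<-trans x<z z<g , x<z)) lo<z ; A≢B = ≢-> z<g }

    odd-case : ∀ h → length lo ≡ suc (h + h) → ψ₂-Result k (ds ++ [ z ])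
    odd-case h lo≡ = shape , involutive , exchange
      where open OddCase h lo≡

  ψ₂-properties : ∀ k X → FallingEnd k X → ψ₂-Result k X
  ψ₂-properties k X record { ds = ds ; z = z ; X≡ = refl ; decreasing = dec ; ds-length = len ; z∉ds = z∉ds
                           ; x₀ = x₀ ; x₀∈ds = x₀∈ds ; x₀<z = x₀<z }
    with parity (length (FallingEndCases.lo k ds z dec len z∉ds x₀ x₀∈ds x₀<z))
  ... | inj₁ (h , even-lo) = FallingEndCases.even-case k ds z dec len z∉ds x₀ x₀∈ds x₀<z h even-lo
  ... | inj₂ (h , odd-lo) = FallingEndCases.odd-case k ds z dec len z∉ds x₀ x₀∈ds x₀<z h odd-lo

module WindowShapes where

  open import Defs
  open Prelude
  open Windows using (at-++ˡ; at-++ʳ)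
  open DecreasingLists
  open RisingStarts using (RisingStart)
  open FallingEnds using (FallingEnd)
  open import Data.Bool using (true; false)
  open import Data.Nat using (ℕ; zero; suc; _+_; _≤_; _<_; z≤n; s≤s; _<ᵇ_)
  open import Data.Nat.Properties
  open import Data.List using (List; []; _∷_; length; _++_; [_])
  open import Data.List.Membership.Propositional using (_∈_; _∉_)
  open import Data.List.Relation.Unary.Any using (here; there)
  open import Data.List.Relation.Unary.All using ([]; _∷_; lookup) renaming (map to All-map)
  open import Data.List.Relation.Unary.AllPairs using ([]; _∷_)
  open import Data.List.Relation.Unary.Unique.Propositional using (Unique)
  open import Data.List.Relation.Unary.Unique.Propositional.Properties using (Unique[x∷xs]⇒x∉xs)
  open import Data.Product using (_,_)
  open import Data.Sum using (inj₁; inj₂)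
  open Sums using (Unique-↭)
  open import Data.List.Relation.Binary.Permutation.Propositional.Properties using (shift)
  open import Data.List.Properties using (++-identityʳ)
  open import Data.Empty using (⊥-elim)
  open import Relation.Binary.PropositionalEquality hiding ([_])
  open import Relation.Binary.Definitions using (tri<; tri≈; tri>)

  window-length : ℕ → ℕ
  window-length k = suc (suc k + suc k)

  at-∈ : ∀ (xs : List ℕ) q → 1 ≤ q → q ≤ length xs → at xs q ∈ xs
  at-∈ (x ∷ xs) (suc zero) _ _ = here refl
  at-∈ (x ∷ xs) (suc (suc q)) _ (s≤s q≤) = there (at-∈ xs (suc q) (s≤s z≤n) q≤)

  decreasing⇒descents : ∀ ds → Decreasing ds → ∀ t → 1 ≤ t → suc t ≤ length ds → isDescent ds t ≡ true
  decreasing⇒descents (x ∷ y ∷ zs) ((y<x ∷ _) ∷ _) (suc zero) _ _ = <ᵇ-true y<x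
  decreasing⇒descents (x ∷ y ∷ zs) (_ ∷ d) (suc (suc t)) _ (s≤s t<) = decreasing⇒descents (y ∷ zs) d (suc t) (s≤s z≤n) t<
  decreasing⇒descents (x ∷ []) _ (suc t) _ (s≤s ())

  descents⇒decreasing : ∀ ds → (∀ t → 1 ≤ t → suc t ≤ length ds → isDescent ds t ≡ true) → Decreasing ds
  descents⇒decreasing [] _ = []
  descents⇒decreasing (x ∷ []) _ = [] ∷ []
  descents⇒decreasing (x ∷ y ∷ zs) desc with descents⇒decreasing (y ∷ zs) (λ { (suc t) _ t< → desc (suc (suc t)) (s≤s z≤n) (s≤s t<) })
  ... | dec@(y> ∷ _) = (y<x ∷ All-map (λ z<y → <-trans z<y y<x) y>) ∷ dec
    where
    y<x : y < x
    y<x = <ᵇ-true⁻ (desc 1 (s≤s z≤n) (s≤s (s≤s z≤n)))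

  last-least : ∀ ds → Decreasing ds → ∀ {x} → x ∈ ds → at ds (length ds) ≤ x
  last-least (x ∷ []) _ (here refl) = ≤-refl
  last-least (x ∷ y ∷ zs) ((y<x ∷ _) ∷ d) (here refl) = ≤-trans (last-least (y ∷ zs) d (here refl)) (<⇒≤ y<x)
  last-least (x ∷ y ∷ zs) (_ ∷ d) (there x∈) = last-least (y ∷ zs) d x∈

  first-greatest : ∀ {d} {xs} → Decreasing (d ∷ xs) → ∀ {x} → x ∈ (d ∷ xs) → x ≤ d
  first-greatest _ (here refl) = ≤-refl
  first-greatest (d> ∷ _) (there x∈) = <⇒≤ (lookup d> x∈)

  rising-start-descents : ∀ k X → RisingStart k X → ∀ t → 1 ≤ t → suc t ≤ window-length k → isDescent X t ≡ (1 <ᵇ t)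
  rising-start-descents k X record { ds = [] ; x₀∈ds = () }
  rising-start-descents k X record { a = a ; ds = d ∷ ds ; X≡ = refl ; decreasing = dec ; ds-length = len ; x₀∈ds = x₀∈ ; a<x₀ = a<x₀ } (suc zero) _ _ =
    <ᵇ-false (λ d<a → <-irrefl refl (<-≤-trans (<-trans d<a a<x₀) (first-greatest dec x₀∈)))
  rising-start-descents k X record { a = a ; ds = d ∷ ds ; X≡ = refl ; decreasing = dec ; ds-length = len } (suc (suc t)) _ (s≤s t<) =
    decreasing⇒descents (d ∷ ds) dec (suc t) (s≤s z≤n) (≤-trans t< (≤-reflexive (sym len)))

  rising-start-from-descents : ∀ k X → length X ≡ window-length k → Unique X →
    (∀ t → 1 ≤ t → suc t ≤ window-length k → isDescent X t ≡ (1 <ᵇ t)) → RisingStart k X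
  rising-start-from-descents k (a ∷ d ∷ ds) len u desc = record
    { a = a ; ds = d ∷ ds ; X≡ = refl
    ; decreasing = descents⇒decreasing (d ∷ ds) (λ { (suc t) _ t< → desc (suc (suc t)) (s≤s z≤n) (s≤s (≤-trans t< (≤-reflexive (suc-injective len)))) })
    ; ds-length = suc-injective len ; a∉ds = a∉ ; x₀ = d ; x₀∈ds = here refl ; a<x₀ = a<d }
    where
    a∉ : a ∉ d ∷ ds
    a∉ = Unique[x∷xs]⇒x∉xs u
    a<d : a < d
    a<d with <-cmp a d
    ... | tri< a<d _ _ = a<d
    ... | tri≈ _ a≡d _ = ⊥-elim (a∉ (here a≡d))
    ... | tri> _ _ d<a = ⊥-elim (<ᵇ-false⁻ (desc 1 (s≤s z≤n) (s≤s (s≤s z≤n))) d<a)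

  private
    at-init : ∀ ds z q → q ≤ length ds → at (ds ++ [ z ]) q ≡ at ds q
    at-init ds z = at-++ˡ ds [ z ]

    at-last : ∀ ds z → at (ds ++ [ z ]) (suc (length ds)) ≡ z
    at-last ds z = trans (cong (at (ds ++ [ z ])) (sym (trans (+-suc (length ds) 0) (cong suc (+-identityʳ _))))) (at-++ʳ ds [ z ] 0)

    descent-init : ∀ ds z t → suc t ≤ length ds → isDescent (ds ++ [ z ]) t ≡ isDescent ds t
    descent-init ds z t t< = cong₂ _<ᵇ_ (at-init ds z (suc t) t<) (at-init ds z t (≤-trans (n≤1+n t) t<))

    descent-last : ∀ ds z → isDescent (ds ++ [ z ]) (length ds) ≡ (z <ᵇ at ds (length ds))
    descent-last ds z = cong₂ _<ᵇ_ (at-last ds z) (at-init ds z (length ds) ≤-refl)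

  falling-end-descents : ∀ k X → FallingEnd k X → ∀ t → 1 ≤ t → suc t ≤ window-length k →
    isDescent X t ≡ (t <ᵇ suc k + suc k)
  falling-end-descents k X record { ds = ds ; z = z ; X≡ = refl ; decreasing = dec ; ds-length = len
                                  ; x₀ = x₀ ; x₀∈ds = x₀∈ ; x₀<z = x₀<z } t 1≤t t<
    with m≤n⇒m<n∨m≡n (≤-pred t<)
  ... | inj₁ t<2k+2 = begin
    isDescent (ds ++ [ z ]) t   ≡⟨ descent-init ds z t (subst (suc t ≤_) (sym len) t<2k+2) ⟩
    isDescent ds t              ≡⟨ decreasing⇒descents ds dec t 1≤t (subst (suc t ≤_) (sym len) t<2k+2) ⟩
    true                        ≡⟨ sym (<ᵇ-true t<2k+2) ⟩
    (t <ᵇ suc k + suc k)        ∎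
    where open ≡-Reasoning
  ... | inj₂ refl = begin
    isDescent (ds ++ [ z ]) (suc k + suc k)      ≡⟨ cong (isDescent (ds ++ [ z ])) (sym len) ⟩
    isDescent (ds ++ [ z ]) (length ds)          ≡⟨ descent-last ds z ⟩
    (z <ᵇ at ds (length ds))                     ≡⟨ <ᵇ-false (λ z<last → <-irrefl refl (<-≤-trans (<-trans x₀<z z<last) (last-least ds dec x₀∈))) ⟩
    false                                        ≡⟨ sym (<ᵇ-false {suc k + suc k} (<-irrefl refl)) ⟩
    (suc k + suc k <ᵇ suc k + suc k)             ∎
    where open ≡-Reasoning

  module FallingEndFromDescents (k : ℕ) (X : List ℕ) (len : length X ≡ window-length k) (u : Unique X)
    (desc : ∀ t → 1 ≤ t → suc t ≤ window-length k → isDescent X t ≡ (t <ᵇ suc k + suc k)) where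

    X≢[] : X ≢ []
    X≢[] X≡[] with trans (sym (cong length X≡[])) len
    ... | ()

    ds : List ℕ
    ds = init₀ X

    z : ℕ
    z = last₀ X

    X≡ : X ≡ ds ++ [ z ]
    X≡ = ∷ʳ-view X X≢[]

    ds-len : length ds ≡ suc k + suc k
    ds-len = suc-injective (trans (sym (length-∷ʳ ds z)) (trans (cong length (sym X≡)) len))

    dec : Decreasing ds
    dec = descents⇒decreasing ds λ t 1≤t t< → begin
      isDescent ds t              ≡⟨ sym (descent-init ds z t t<) ⟩
      isDescent (ds ++ [ z ]) t   ≡⟨ cong (λ Y → isDescent Y t) (sym X≡) ⟩
      isDescent X t               ≡⟨ desc t 1≤t (s≤s (<⇒≤ (t<2k+2 t<))) ⟩
      (t <ᵇ suc k + suc k)        ≡⟨ <ᵇ-true (t<2k+2 t<) ⟩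
      true                        ∎
      where
      open ≡-Reasoning
      t<2k+2 : ∀ {t} → suc t ≤ length ds → suc t ≤ suc k + suc k
      t<2k+2 = subst (_ ≤_) ds-len

    z∉ds : z ∉ ds
    z∉ds z∈ = Unique[x∷xs]⇒x∉xs (Unique-↭ (shift z ds []) (subst Unique X≡ u)) (subst (z ∈_) (sym (++-identityʳ ds)) z∈)

    last∈ : at ds (length ds) ∈ ds
    last∈ = at-∈ ds (length ds) (subst (1 ≤_) (sym ds-len) (s≤s z≤n)) ≤-refl

    z≮last : (z <ᵇ at ds (length ds)) ≡ false
    z≮last = begin
      (z <ᵇ at ds (length ds))               ≡⟨ sym (descent-last ds z) ⟩
      isDescent (ds ++ [ z ]) (length ds)    ≡⟨ cong (λ Y → isDescent Y (length ds)) (sym X≡) ⟩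
      isDescent X (length ds)                ≡⟨ cong (isDescent X) ds-len ⟩
      isDescent X (suc k + suc k)            ≡⟨ desc (suc k + suc k) (s≤s z≤n) ≤-refl ⟩
      (suc k + suc k <ᵇ suc k + suc k)       ≡⟨ <ᵇ-false {suc k + suc k} (<-irrefl refl) ⟩
      false                                  ∎
      where open ≡-Reasoning

    last<z : at ds (length ds) < z
    last<z with <-cmp (at ds (length ds)) z
    ... | tri< last<z _ _ = last<z
    ... | tri≈ _ last≡z _ = ⊥-elim (z∉ds (subst (_∈ ds) last≡z last∈))
    ... | tri> _ _ z<last = ⊥-elim (<ᵇ-false⁻ z≮last z<last)

  falling-end-from-descents : ∀ k X → length X ≡ window-length k → Unique X →
    (∀ t → 1 ≤ t → suc t ≤ window-length k → isDescent X t ≡ (t <ᵇ suc k + suc k)) → FallingEnd k X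
  falling-end-from-descents k X len u desc = record
    { ds = ds ; z = z ; X≡ = X≡ ; decreasing = dec ; ds-length = ds-len ; z∉ds = z∉ds
    ; x₀ = at ds (length ds) ; x₀∈ds = last∈ ; x₀<z = last<z }
    where open FallingEndFromDescents k X len u desc

module Proof where

  open import Defs
  open Prelude
  open Sums
  open Permutations using (keep-∈; ∈-keep; Sn-∈)
  open Windows
  open WindowInvolutions
  open RisingStarts
  open FallingEnds
  open WindowShapes
  open import Data.Bool using (Bool; true; false; _∧_; not)
  open import Data.Bool.Properties using (∧-identityʳ; ∧-zeroʳ)
  open import Data.Nat using (ℕ; zero; suc; _+_; _*_; _∸_; _≤_; _<_; z≤n; s≤s; _<ᵇ_; _≡ᵇ_; _≟_)
  open import Data.Nat.Properties
  open import Data.Nat.Tactic.RingSolver using (solve-∀)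
  open import Data.Integer using (ℤ; 0ℤ) renaming (_+_ to _+ℤ_)
  import Data.Integer.Properties as ℤ
  open import Data.List using (List; []; _∷_; map; length)
  open import Data.List.Membership.Propositional using (_∈_; _∉_)
  open import Data.List.Membership.Propositional.Properties using (∈-++⁺ˡ; ∈-++⁺ʳ; ∈-++⁻)
  open import Data.List.Relation.Unary.Any using (here; there)
  open import Data.List.Relation.Unary.All using (All; lookup)
  open import Data.List.Relation.Unary.Unique.Propositional using (Unique)
  open import Data.List.Relation.Unary.Unique.Propositional.Properties using (take⁺; drop⁺)
  open import Data.Product using (_×_; _,_; proj₁; proj₂)
  open import Data.Sum using (inj₁; inj₂)
  open import Relation.Nullary using (yes; no)
  open import Relation.Binary.PropositionalEquality

  Σ-keep : {X : Set} (q : X → Bool) (f : X → ℤ) (xs : List X) → sumℤ (map f (keep q xs)) ≡ Σ[ xs ] (restrict q f)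
  Σ-keep q f [] = refl
  Σ-keep q f (x ∷ xs) with q x
  ... | true = cong (f x +ℤ_) (Σ-keep q f xs)
  ... | false = trans (Σ-keep q f xs) (sym (ℤ.+-identityˡ _))

  genCoeff-as-Σ : ∀ n I J d → genCoeff n I J d ≡ Σ[ Sn n ] (restrict (inDIJ I J) (weight n d))
  genCoeff-as-Σ n I J d = trans (Σ-keep (λ σ → Lstat n σ ≡ᵇ d) (λ σ → sign (ℓ n σ)) (DIJ n I J))
                                (Σ-keep (inDIJ I J) (weight n d) (Sn n))

  all-true⁻ : {A : Set} (p : A → Bool) (xs : List A) → all p xs ≡ true → ∀ {x} → x ∈ xs → p x ≡ true
  all-true⁻ p (y ∷ xs) eq (here refl) = proj₁ (∧-true⁻ {p y} eq)
  all-true⁻ p (y ∷ xs) eq (there x∈) = all-true⁻ p xs (proj₂ (∧-true⁻ {p y} eq)) x∈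

  all-cong : {A : Set} {p q : A → Bool} (xs : List A) → (∀ {x} → x ∈ xs → p x ≡ q x) → all p xs ≡ all q xs
  all-cong [] _ = refl
  all-cong (x ∷ xs) p≡q = cong₂ _∧_ (p≡q (here refl)) (all-cong xs (λ x∈ → p≡q (there x∈)))

  all-true⁺ : {A : Set} (p : A → Bool) (xs : List A) → (∀ {x} → x ∈ xs → p x ≡ true) → all p xs ≡ true
  all-true⁺ p [] _ = refl
  all-true⁺ p (x ∷ xs) h rewrite h (here refl) = all-true⁺ p xs (λ x∈ → h (there x∈))

  all-same-members : {A : Set} (p : A → Bool) (xs ys : List A) →
    (∀ {x} → x ∈ xs → x ∈ ys) → (∀ {x} → x ∈ ys → x ∈ xs) → all p xs ≡ all p ys
  all-same-members p xs ys xs⊆ys ys⊆xs with all p xs in eq-xs | all p ys in eq-ys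
  ... | true | true = refl
  ... | false | false = refl
  ... | true | false = trans (sym (all-true⁺ p ys λ y∈ → all-true⁻ p xs eq-xs (ys⊆xs y∈))) eq-ys
  ... | false | true = trans (sym eq-xs) (all-true⁺ p xs λ x∈ → all-true⁻ p ys eq-ys (xs⊆ys x∈))

  inDIJ-local : ∀ I K σ τ → (∀ {j} → j ∈ I ∪ K → isDescent τ j ≡ isDescent σ j) → inDIJ I K τ ≡ inDIJ I K σ
  inDIJ-local I K σ τ same = cong₂ _∧_ (all-cong K (λ j∈ → same (∈-++⁺ʳ I j∈)))
                                       (all-cong I (λ j∈ → cong not (same (∈-++⁺ˡ j∈))))

  inDIJ-∷ : ∀ I K d σ → inDIJ I (d ∷ K) σ ≡ inDIJ I K σ ∧ isDescent σ d
  inDIJ-∷ I K d σ = rotate (isDescent σ d) (all (isDescent σ) K) (all (λ a → not (isDescent σ a)) I)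
    where
    rotate : ∀ a b c → (a ∧ b) ∧ c ≡ (b ∧ c) ∧ a
    rotate true b c = sym (∧-identityʳ _)
    rotate false b c = sym (∧-zeroʳ _)

  remove-∈ : ∀ e (J : List ℕ) {x} → x ∈ remove e J → x ∈ J × x ≢ e
  remove-∈ e J {x} x∈ with keep-∈ (λ b → not (b ≡ᵇ e)) J x∈
  ... | x∈J , x≢ᵇe = x∈J , ≡ᵇ-false⁻ {x} (not-true⁻ x≢ᵇe)

  ∈-remove : ∀ e (J : List ℕ) {x} → x ∈ J → x ≢ e → x ∈ remove e J
  ∈-remove e J {x} x∈J x≢e = ∈-keep (λ b → not (b ≡ᵇ e)) J x∈J (cong not (≡ᵇ-false x≢e))

  -- Proposition 3.10, for i = p0 + 1 and n = n′ + 1.  The window is the block of positions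
  -- i, ..., i + 2k + 2 (offset p0, length m = 2k + 3); its neighbours i - 1 = p0 and
  -- i + 2k + 2 = p0 + m lie outside I ∪ J.
  module Proposition (n′ : ℕ) (I J : List ℕ) (p0 k : ℕ)
    (J-range : All (λ a → 1 ≤ a × a ≤ suc n′ ∸ 1) J)
    (J-block : ∀ a → suc p0 + 1 ≤ a → a ≤ suc p0 + 2 * k + 1 → a ∈ J)
    (before∉ : p0 ∉ I ∪ J) (after∉ : suc p0 + 2 * k + 2 ∉ I ∪ J) where

    n i m e : ℕ
    n = suc n′
    i = suc p0
    m = window-length k
    e = i + 2 * k + 1

    J̄ : List ℕ
    J̄ = Jbar i k J

    private
      e≡ : e ≡ p0 + (suc k + suc k)
      e≡ = arith p0 k
        where
        arith : ∀ p0 k → suc p0 + 2 * k + 1 ≡ p0 + (suc k + suc k)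
        arith = solve-∀

      end≡ : suc p0 + 2 * k + 2 ≡ p0 + m
      end≡ = arith p0 k
        where
        arith : ∀ p0 k → suc p0 + 2 * k + 2 ≡ p0 + suc (suc k + suc k)
        arith = solve-∀

      i≡ : p0 + 1 ≡ i
      i≡ = +-comm p0 1

    block∈J : ∀ t → 2 ≤ t → t ≤ suc k + suc k → p0 + t ∈ J
    block∈J t 2≤t t≤ = J-block (p0 + t) (subst (_≤ p0 + t) (+-suc p0 1) (+-monoʳ-≤ p0 2≤t))
                                        (subst (p0 + t ≤_) (sym e≡) (+-monoʳ-≤ p0 t≤))

    e∈J : e ∈ J
    e∈J = subst (_∈ J) (sym e≡) (block∈J (suc k + suc k) (s≤s (≤-trans (s≤s z≤n) (m≤n+m (suc k) k))) ≤-refl)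

    fits : p0 + m ≤ n
    fits = subst (_≤ n) (arith p0 k) (s≤s (proj₂ (lookup J-range e∈J)))
      where
      arith : ∀ p0 k → suc (suc p0 + 2 * k + 1) ≡ p0 + suc (suc k + suc k)
      arith = solve-∀

    away : ∀ {j} → j ∈ I ∪ J → j ≢ p0 × j ≢ p0 + m
    away j∈ = (λ j≡p0 → before∉ (subst (_∈ I ∪ J) j≡p0 j∈)) , (λ j≡end → after∉ (subst (_∈ I ∪ J) (trans j≡end (sym end≡)) j∈))

    i-away : i ≢ p0 × i ≢ p0 + m
    i-away = (λ i≡p0 → 1+n≰n (≤-reflexive i≡p0)) , <⇒≢ i<end
      where
      i<end : i < p0 + m
      i<end = subst (_≤ p0 + m) (+-comm p0 2) (+-monoʳ-≤ p0 (s≤s (s≤s z≤n)))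

    open Window p0 m using (win; Fits; win-length; descent-window)

    private
      fits-σ : ∀ {σ} → σ ∈ Sn n → Fits σ
      fits-σ σ∈ = subst (p0 + m ≤_) (sym (proj₁ (Sn-∈ n σ∈))) fits

      window-length-σ : ∀ {σ} → σ ∈ Sn n → length (win σ) ≡ m
      window-length-σ σ∈ = win-length _ (fits-σ σ∈)

      window-unique : ∀ {σ} → σ ∈ Sn n → Unique (win σ)
      window-unique σ∈ = take⁺ m (drop⁺ p0 (proj₂ (proj₂ (Sn-∈ n σ∈))))

      window-descents : ∀ {σ} → σ ∈ Sn n → (expected : ℕ → Bool) →
        (∀ t → 1 ≤ t → suc t ≤ m → isDescent σ (p0 + t) ≡ expected t) →
        ∀ t → 1 ≤ t → suc t ≤ m → isDescent (win σ) t ≡ expected t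
      window-descents σ∈ expected σ-pattern t 1≤t t< = trans (sym (descent-window _ (fits-σ σ∈) t 1≤t t<)) (σ-pattern t 1≤t t<)

      defect-parts : ∀ K j σ → (inDIJ I K σ ∧ not (isDescent σ j)) ≡ true →
        (∀ {x} → x ∈ K → isDescent σ x ≡ true) × isDescent σ j ≡ false
      defect-parts K j σ eq with ∧-true⁻ {inDIJ I K σ} eq
      ... | in-D , not-j = all-true⁻ _ K (proj₁ (∧-true⁻ {all (isDescent σ) K} in-D)) , not-true⁻ not-j

    Defect₁ : List ℕ → Bool
    Defect₁ σ = inDIJ I J σ ∧ not (isDescent σ i)

    defect₁-shape : ∀ σ → σ ∈ Sn n → Defect₁ σ ≡ true → RisingStart k (win σ)
    defect₁-shape σ σ∈ defect = rising-start-from-descents k (win σ) (window-length-σ σ∈) (window-unique σ∈)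
      (window-descents σ∈ (1 <ᵇ_) σ-pattern)
      where
      parts : (∀ {x} → x ∈ J → isDescent σ x ≡ true) × isDescent σ i ≡ false
      parts = defect-parts J i σ defect
      σ-pattern : ∀ t → 1 ≤ t → suc t ≤ m → isDescent σ (p0 + t) ≡ (1 <ᵇ t)
      σ-pattern (suc zero) _ _ = trans (cong (isDescent σ) i≡) (proj₂ parts)
      σ-pattern (suc (suc t)) _ (s≤s t<) = proj₁ parts (block∈J (suc (suc t)) (s≤s (s≤s z≤n)) t<)

    defect₁-local : ∀ σ τ → (∀ j → j ≢ p0 → j ≢ p0 + m → isDescent τ j ≡ isDescent σ j) → Defect₁ τ ≡ Defect₁ σ
    defect₁-local σ τ same = cong₂ _∧_ (inDIJ-local I J σ τ (λ j∈ → same _ (proj₁ (away j∈)) (proj₂ (away j∈))))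
                                       (cong not (same i (proj₁ i-away) (proj₂ i-away)))

    defect₁-vanishes : ∀ d → Σ[ Sn n ] (restrict Defect₁ (weight n d)) ≡ 0ℤ
    defect₁-vanishes = WindowInvolution.defect-vanishes n p0 m fits (RisingStart k) ψ₁
      (λ X s → proj₁ (ψ₁-properties k X s)) (λ X s → proj₁ (proj₂ (ψ₁-properties k X s)))
      (λ X s → proj₂ (proj₂ (ψ₁-properties k X s)))
      (λ X Y sX sY t 1≤t t< → trans (rising-start-descents k X sX t 1≤t t<) (sym (rising-start-descents k Y sY t 1≤t t<)))
      Defect₁ defect₁-shape defect₁-local

    union-i : ∀ σ → inDIJ I (J ∪ J̄) σ ≡ inDIJ I J σ ∧ isDescent σ i
    union-i σ = trans (cong (_∧ _) (all-same-members (isDescent σ) (J ∪ J̄) (i ∷ J) ⊆ ⊇)) (inDIJ-∷ I J i σ)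
      where
      ⊆ : ∀ {x} → x ∈ J ∪ J̄ → x ∈ i ∷ J
      ⊆ x∈ with ∈-++⁻ J x∈
      ... | inj₁ x∈J = there x∈J
      ... | inj₂ (here x≡i) = here x≡i
      ... | inj₂ (there x∈J∖e) = there (proj₁ (remove-∈ e J x∈J∖e))
      ⊇ : ∀ {x} → x ∈ i ∷ J → x ∈ J ∪ J̄
      ⊇ (here x≡i) = ∈-++⁺ʳ J (here x≡i)
      ⊇ (there x∈J) = ∈-++⁺ˡ x∈J

    claim₁ : PolyEq (genCoeff n I J) (genCoeff n I (J ∪ J̄))
    claim₁ d = begin
      genCoeff n I J d                                     ≡⟨ genCoeff-as-Σ n I J d ⟩
      Σ[ Sn n ] (restrict (inDIJ I J) w)                   ≡⟨ Σ-restrict-split (inDIJ I J) (λ σ → isDescent σ i) w (Sn n) ⟩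
      Σ[ Sn n ] (restrict (λ σ → inDIJ I J σ ∧ isDescent σ i) w) +ℤ Σ[ Sn n ] (restrict Defect₁ w)
                                                           ≡⟨ cong₂ _+ℤ_ (Σ-restrict-cong w (Sn n) (λ σ → sym (union-i σ))) (defect₁-vanishes d) ⟩
      Σ[ Sn n ] (restrict (inDIJ I (J ∪ J̄)) w) +ℤ 0ℤ   ≡⟨ ℤ.+-identityʳ _ ⟩
      Σ[ Sn n ] (restrict (inDIJ I (J ∪ J̄)) w)            ≡⟨ sym (genCoeff-as-Σ n I (J ∪ J̄) d) ⟩
      genCoeff n I (J ∪ J̄) d                               ∎
      where
      open ≡-Reasoning
      w : List ℕ → ℤ
      w = weight n d

    Defect₂ : List ℕ → Bool
    Defect₂ σ = inDIJ I J̄ σ ∧ not (isDescent σ e)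

    defect₂-shape : ∀ σ → σ ∈ Sn n → Defect₂ σ ≡ true → FallingEnd k (win σ)
    defect₂-shape σ σ∈ defect = falling-end-from-descents k (win σ) (window-length-σ σ∈) (window-unique σ∈)
      (window-descents σ∈ (_<ᵇ suc k + suc k) σ-pattern)
      where
      parts : (∀ {x} → x ∈ J̄ → isDescent σ x ≡ true) × isDescent σ e ≡ false
      parts = defect-parts J̄ e σ defect
      σ-pattern : ∀ t → 1 ≤ t → suc t ≤ m → isDescent σ (p0 + t) ≡ (t <ᵇ suc k + suc k)
      σ-pattern (suc zero) _ _ =
        trans (cong (isDescent σ) i≡) (trans (proj₁ parts (here refl)) (sym (<ᵇ-true (s≤s (≤-trans (s≤s z≤n) (m≤n+m (suc k) k))))))
      σ-pattern (suc (suc t)) _ (s≤s t<) with m≤n⇒m<n∨m≡n t<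
      ... | inj₁ t<2k+2 = trans (proj₁ parts (there (∈-remove e J (block∈J (suc (suc t)) (s≤s (s≤s z≤n)) (<⇒≤ t<2k+2)) ≢e)))
                                (sym (<ᵇ-true t<2k+2))
        where
        ≢e : p0 + suc (suc t) ≢ e
        ≢e eq = <⇒≢ t<2k+2 (+-cancelˡ-≡ p0 _ _ (trans eq e≡))
      ... | inj₂ t≡2k+2 = begin
        isDescent σ (p0 + suc (suc t))        ≡⟨ cong (λ t′ → isDescent σ (p0 + t′)) t≡2k+2 ⟩
        isDescent σ (p0 + (suc k + suc k))    ≡⟨ cong (isDescent σ) (sym e≡) ⟩
        isDescent σ e                         ≡⟨ proj₂ parts ⟩
        false                                 ≡⟨ sym (<ᵇ-false (<-irrefl t≡2k+2)) ⟩
        (suc (suc t) <ᵇ suc k + suc k)        ∎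
        where open ≡-Reasoning

    defect₂-local : ∀ σ τ → (∀ j → j ≢ p0 → j ≢ p0 + m → isDescent τ j ≡ isDescent σ j) → Defect₂ τ ≡ Defect₂ σ
    defect₂-local σ τ same = cong₂ _∧_ (inDIJ-local I J̄ σ τ (λ j∈ → same _ (proj₁ (away′ j∈)) (proj₂ (away′ j∈))))
                                       (cong not (same e (proj₁ e-away) (proj₂ e-away)))
      where
      e-away : e ≢ p0 × e ≢ p0 + m
      e-away = away (∈-++⁺ʳ I e∈J)
      away′ : ∀ {j} → j ∈ I ∪ J̄ → j ≢ p0 × j ≢ p0 + m
      away′ j∈ with ∈-++⁻ I j∈
      ... | inj₁ j∈I = away (∈-++⁺ˡ j∈I)
      ... | inj₂ (here refl) = i-away
      ... | inj₂ (there j∈J∖e) = away (∈-++⁺ʳ I (proj₁ (remove-∈ e J j∈J∖e)))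

    defect₂-vanishes : ∀ d → Σ[ Sn n ] (restrict Defect₂ (weight n d)) ≡ 0ℤ
    defect₂-vanishes = WindowInvolution.defect-vanishes n p0 m fits (FallingEnd k) ψ₂
      (λ X s → proj₁ (ψ₂-properties k X s)) (λ X s → proj₁ (proj₂ (ψ₂-properties k X s)))
      (λ X s → proj₂ (proj₂ (ψ₂-properties k X s)))
      (λ X Y sX sY t 1≤t t< → trans (falling-end-descents k X sX t 1≤t t<) (sym (falling-end-descents k Y sY t 1≤t t<)))
      Defect₂ defect₂-shape defect₂-local

    -- as sets, J ∪ J̄ = J̄ ∪ {e}, since e ∈ J
    union-e : ∀ σ → inDIJ I (J ∪ J̄) σ ≡ inDIJ I J̄ σ ∧ isDescent σ e
    union-e σ = trans (cong (_∧ _) (all-same-members (isDescent σ) (J ∪ J̄) (e ∷ J̄) ⊆ ⊇)) (inDIJ-∷ I J̄ e σ)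
      where
      ⊆ : ∀ {x} → x ∈ J ∪ J̄ → x ∈ e ∷ J̄
      ⊆ {x} x∈ with ∈-++⁻ J x∈
      ... | inj₂ x∈J̄ = there x∈J̄
      ... | inj₁ x∈J with x ≟ e
      ...   | yes x≡e = here x≡e
      ...   | no x≢e = there (there (∈-remove e J x∈J x≢e))
      ⊇ : ∀ {x} → x ∈ e ∷ J̄ → x ∈ J ∪ J̄
      ⊇ (here refl) = ∈-++⁺ˡ e∈J
      ⊇ (there x∈J̄) = ∈-++⁺ʳ J x∈J̄

    claim₂ : PolyEq (genCoeff n I (J ∪ J̄)) (genCoeff n I J̄)
    claim₂ d = begin
      genCoeff n I (J ∪ J̄) d                              ≡⟨ genCoeff-as-Σ n I (J ∪ J̄) d ⟩
      Σ[ Sn n ] (restrict (inDIJ I (J ∪ J̄)) w)            ≡⟨ sym (ℤ.+-identityʳ _) ⟩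
      Σ[ Sn n ] (restrict (inDIJ I (J ∪ J̄)) w) +ℤ 0ℤ   ≡⟨ cong₂ _+ℤ_ (Σ-restrict-cong w (Sn n) union-e) (sym (defect₂-vanishes d)) ⟩
      Σ[ Sn n ] (restrict (λ σ → inDIJ I J̄ σ ∧ isDescent σ e) w) +ℤ Σ[ Sn n ] (restrict Defect₂ w)
                                                           ≡⟨ sym (Σ-restrict-split (inDIJ I J̄) (λ σ → isDescent σ e) w (Sn n)) ⟩
      Σ[ Sn n ] (restrict (inDIJ I J̄) w)                  ≡⟨ sym (genCoeff-as-Σ n I J̄ d) ⟩
      genCoeff n I J̄ d                                     ∎
      where
      open ≡-Reasoning
      w : List ℕ → ℤ
      w = weight n d

proposition3p10 : (n : ℕ) → 1 ≤ n → (I J : List ℕ)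
    → All (λ a → 1 ≤ a × a ≤ n ∸ 1) I → All (λ a → 1 ≤ a × a ≤ n ∸ 1) J
    → (∀ a → a ∈ I → a ∉ J)
    → (i k : ℕ) → 1 ≤ i
    → (∀ a → i + 1 ≤ a → a ≤ i + 2 * k + 1 → a ∈ I ∪ J)
    → i ∉ I ∪ J → (i + 2 * k + 2) ∉ I ∪ J
    → (∀ a → i + 1 ≤ a → a ≤ i + 2 * k + 1 → a ∈ J)
    → (i ∸ 1) ∉ I ∪ J
    → PolyEq (genCoeff n I J) (genCoeff n I (J ∪ (Jbar i k J)))
      × PolyEq (genCoeff n I (J ∪ (Jbar i k J))) (genCoeff n I (Jbar i k J))
proposition3p10 (suc n′) _ I J _ J-range _ (suc p0) k _ _ _ after∉ J-block before∉ = claim₁ , claim₂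
  where open Proof.Proposition n′ I J p0 k J-range J-block before∉ after∉
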